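{- For every integer $n\ge 0$, \[ \overline{p}_o(n)=\sum_{k=-\infty}^{\infty}(-1)^{\lceil k/2\rceil}\,p\!\left(n-\frac{k(3k+1)}{2}\right). \]
   Context: $p(n)$ is the number of (unrestricted) partitions of $n$. $\overline{p}_o(n)$ denotes the number of overpartitions of $n$ into odd parts (partitions into odd parts in which the first occurrence of each part size may be overlined); $\sum_{n\ge0}\overline{p}_o(n)q^n=\frac{(-q;q^2)_\infty}{(q;q^2)_\infty}$, where $(a;q)_\infty=\prod_{k\ge1}(1-aq^{k-1})$. Convention: $p(x)=0$ whenever $x$ is not a nonnegative integer. -}

module Defs where

open import Data.Nat as ℕ using (ℕ; zero; suc; _≤ᵇ_; _≡ᵇ_)
open import Data.Nat.DivMod using (_/_; _%_)
open import Data.Bool using (Bool; true; false; _∧_; _∨_; not; if_then_else_)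
open import Data.List using (List; []; _∷_; map; concatMap; length; filterᵇ; upTo)
open import Data.Nat.ListAction using (sum)
open import Data.Integer.DivMod using (_/ℕ_)
open import Data.Product using (_×_; _,_; proj₁; proj₂)
open import Data.Integer as ℤ using (ℤ; +_; -[1+_]; ∣_∣)

listsUpTo : {A : Set} → ℕ → List A → List (List A)
listsUpTo zero    xs = [] ∷ []
listsUpTo (suc l) xs = [] ∷ concatMap (λ x → map (x ∷_) (listsUpTo l xs)) xs

oneTo : ℕ → List ℕ
oneTo n = map suc (upTo n)

-- Partitions: a partition of n is a nonincreasing list of positive
-- integers summing to n.

nonincreasing : List ℕ → Bool
nonincreasing []             = true
nonincreasing (x ∷ [])       = true
nonincreasing (x ∷ y ∷ rest) = (y ≤ᵇ x) ∧ nonincreasing (y ∷ rest)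

isPartitionOf : ℕ → List ℕ → Bool
isPartitionOf n xs = nonincreasing xs ∧ (sum xs ≡ᵇ n)

-- every partition of n has at most n parts, each in 1..n
partitions : ℕ → List (List ℕ)
partitions n = filterᵇ (isPartitionOf n) (listsUpTo n (oneTo n))

p : ℕ → ℕ
p n = length (partitions n)

-- Overpartitions into odd parts: nonincreasing list of parts (part, overlined?),
-- all parts odd, summing to n, where only the first occurrence of each
-- part size may be overlined.

isOdd : ℕ → Bool
isOdd m = (m % 2) ≡ᵇ 1

overOK : List (ℕ × Bool) → Bool
overOK []             = true
overOK (x ∷ [])       = true
overOK ((a , b) ∷ (a' , b') ∷ rest) =
  (a' ≤ᵇ a) ∧ (not (a' ≡ᵇ a) ∨ not b') ∧ overOK ((a' , b') ∷ rest)

allOdd : List (ℕ × Bool) → Bool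
allOdd []             = true
allOdd ((a , _) ∷ xs) = isOdd a ∧ allOdd xs

isOddOverpartitionOf : ℕ → List (ℕ × Bool) → Bool
isOddOverpartitionOf n xs = overOK xs ∧ allOdd xs ∧ (sum (map proj₁ xs) ≡ᵇ n)

pairsOneTo : ℕ → List (ℕ × Bool)
pairsOneTo n = concatMap (λ a → (a , false) ∷ (a , true) ∷ []) (oneTo n)

oddOverpartitions : ℕ → List (List (ℕ × Bool))
oddOverpartitions n = filterᵇ (isOddOverpartitionOf n) (listsUpTo n (pairsOneTo n))

pbarO : ℕ → ℕ
pbarO n = length (oddOverpartitions n)

pℤ : ℤ → ℕ
pℤ (+ m)    = p m
pℤ -[1+ m ] = 0

-- k(3k+1)/2 (k(3k+1) is always an even integer)
pent : ℤ → ℤ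
pent k = (k ℤ.* (+ 3 ℤ.* k ℤ.+ + 1)) /ℕ 2

ceilHalf : ℤ → ℤ
ceilHalf (+ m)    = + ((suc m) / 2)
ceilHalf -[1+ m ] = ℤ.- (+ ((suc m) / 2))

negOnePow : ℤ → ℤ
negOnePow j = if isOdd ∣ j ∣ then ℤ.-1ℤ else ℤ.1ℤ

term : ℕ → ℤ → ℤ
term n k = negOnePow (ceilHalf k) ℤ.* (+ pℤ (+ n ℤ.- pent k))

symSum : ℕ → (ℤ → ℤ) → ℤ
symSum zero    f = f (+ 0)
symSum (suc N) f = symSum N f ℤ.+ f (+ suc N) ℤ.+ f (ℤ.- (+ suc N))

-- An odd overpartition is a pair of partitions into odd parts, one of them into distinct
-- parts, so its generating series is ∏_{i odd} (1 + q^i)/(1 - q^i) = (-q;-q)_∞ / (q;q)_∞.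
-- Working with parts at most N, induction on N shows that the odd overpartitions with parts
-- ≤ N have generating series (-q;-q)_N P_N(q), where P_N counts partitions into parts ≤ N.
-- By Shanks' finite form of Euler's pentagonal theorem, (q;q)_N agrees with
-- ∑_{|k| ≤ N} (-1)^k q^(k(3k+1)/2) below degree N + 1. Replacing q by -q turns the sign into
-- (-1)^(k + k(3k+1)/2) = (-1)^⌈k/2⌉, and the coefficient of q^n for n ≤ N is the formula.

module Submission where

open import Defs
open import Data.Nat using (ℕ; _≤_)
open import Relation.Binary.PropositionalEquality using (_≡_)

module Comparisons where

  open import Data.Nat using (ℕ; zero; suc; _+_; _∸_; _≤_; _<_; _≤ᵇ_; _≡ᵇ_; z≤n; s≤s)
  open import Data.Nat.Properties
    using (≤-trans; ≤⇒≤ᵇ; ≤ᵇ⇒≤; <⇒≱; ≰⇒>; ∸-monoʳ-≤; ∸-monoˡ-≤; +-∸-assoc; m≤m+n; m+n∸m≡n)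
  open import Data.Bool using (true; false; _∧_)
  open import Data.Bool.Properties using (T-≡)
  open import Function.Bundles using (Equivalence)
  open import Relation.Nullary using (contradiction)
  open import Relation.Binary.PropositionalEquality

  module _ {m n : ℕ} where

    ≤ᵇ-true : m ≤ n → (m ≤ᵇ n) ≡ true
    ≤ᵇ-true m≤n = Equivalence.to T-≡ (≤⇒≤ᵇ m≤n)

    ≤ᵇ-true⁻¹ : (m ≤ᵇ n) ≡ true → m ≤ n
    ≤ᵇ-true⁻¹ eq = ≤ᵇ⇒≤ m n (Equivalence.from T-≡ eq)

    ≤ᵇ-false : n < m → (m ≤ᵇ n) ≡ false
    ≤ᵇ-false n<m with m ≤ᵇ n in eq
    ... | false = refl
    ... | true  = contradiction (≤ᵇ-true⁻¹ eq) (<⇒≱ n<m)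

    ≤ᵇ-false⁻¹ : (m ≤ᵇ n) ≡ false → n < m
    ≤ᵇ-false⁻¹ eq = ≰⇒> (λ m≤n → contradiction (trans (sym (≤ᵇ-true m≤n)) eq) λ ())

  ∸-suc-≤ : {s k : ℕ} (i : ℕ) → s ≤ suc k → s ∸ suc i ≤ k
  ∸-suc-≤ {s} i s≤1+k = ≤-trans (∸-monoʳ-≤ s (s≤s (z≤n {i}))) (∸-monoˡ-≤ 1 s≤1+k)

  suc-+∸ : (k d : ℕ) → suc (k + d) ∸ k ≡ suc d
  suc-+∸ k d = trans (+-∸-assoc 1 (m≤m+n k d)) (cong suc (m+n∸m≡n k d))

  1+≤ᵇ1+ : (m n : ℕ) → (suc m ≤ᵇ suc n) ≡ (m ≤ᵇ n)
  1+≤ᵇ1+ zero    n = refl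
  1+≤ᵇ1+ (suc m) n = refl

  +-≡ᵇ : (x t s : ℕ) → (x + t ≡ᵇ s) ≡ (x ≤ᵇ s) ∧ (t ≡ᵇ s ∸ x)
  +-≡ᵇ zero    t s       = refl
  +-≡ᵇ (suc x) t zero    = refl
  +-≡ᵇ (suc x) t (suc s) = trans (+-≡ᵇ x t s) (cong (_∧ (t ≡ᵇ s ∸ x)) (sym (1+≤ᵇ1+ x s)))

  ≡ᵇ-refl : (a : ℕ) → (a ≡ᵇ a) ≡ true
  ≡ᵇ-refl zero    = refl
  ≡ᵇ-refl (suc a) = ≡ᵇ-refl a

  <⇒≡ᵇ-false : {i a : ℕ} → i < a → (i ≡ᵇ a) ≡ false
  <⇒≡ᵇ-false {zero}  {suc a} _         = refl
  <⇒≡ᵇ-false {suc i} {suc a} (s≤s i<a) = <⇒≡ᵇ-false i<a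

module Counting where

  open import Data.Nat using (ℕ; zero; suc; _+_; _≤_; _<_; z≤n; s≤s)
  open import Data.Nat.Properties using (+-assoc; +-identityʳ; ≤-pred; ≤∧≢⇒<; _≟_)
  open import Data.Nat.ListAction using (sum)
  open import Data.Nat.ListAction.Properties using (sum-++)
  open import Data.Bool using (Bool; true; false; _∧_; if_then_else_)
  open import Data.List using (List; []; _∷_; map; concatMap; length; filterᵇ; _++_; applyUpTo)
  open import Data.List.Properties using (map-++; map-∘; length-++; filter-++)
  open import Function using (_∘_)
  open import Relation.Nullary using (yes; no)
  open import Relation.Nullary.Decidable using (T?)
  open import Relation.Binary.PropositionalEquality
  open ≡-Reasoning

  𝟙 : Bool → ℕ
  𝟙 true  = 1
  𝟙 false = 0

  count : {A : Set} → (A → Bool) → List A → ℕ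
  count q xs = length (filterᵇ q xs)

  module _ {A : Set} where

    count-∷ : (q : A → Bool) (x : A) (xs : List A) → count q (x ∷ xs) ≡ 𝟙 (q x) + count q xs
    count-∷ q x xs with q x
    ... | true  = refl
    ... | false = refl

    count-++ : (q : A → Bool) (xs ys : List A) → count q (xs ++ ys) ≡ count q xs + count q ys
    count-++ q xs ys = trans (cong length (filter-++ (T? ∘ q) xs ys)) (length-++ (filterᵇ q xs))

    count-cong : {q r : A → Bool} → (∀ x → q x ≡ r x) → (xs : List A) → count q xs ≡ count r xs
    count-cong e []       = refl
    count-cong {q} {r} e (x ∷ xs) = begin
      count q (x ∷ xs)       ≡⟨ count-∷ q x xs ⟩
      𝟙 (q x) + count q xs   ≡⟨ cong₂ _+_ (cong 𝟙 (e x)) (count-cong e xs) ⟩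
      𝟙 (r x) + count r xs   ≡⟨ count-∷ r x xs ⟨
      count r (x ∷ xs)       ∎

    count-guard : (g : Bool) (q : A → Bool) (xs : List A) →
                  count (λ y → g ∧ q y) xs ≡ (if g then count q xs else 0)
    count-guard true  q xs       = refl
    count-guard false q []       = refl
    count-guard false q (x ∷ xs) = count-guard false q xs

  count-map : {A B : Set} (q : B → Bool) (f : A → B) (xs : List A) →
              count q (map f xs) ≡ count (q ∘ f) xs
  count-map q f []       = refl
  count-map q f (x ∷ xs) = trans (count-∷ q (f x) (map f xs))
    (trans (cong (𝟙 (q (f x)) +_) (count-map q f xs)) (sym (count-∷ (q ∘ f) x xs)))

  count-concatMap : {A B : Set} (q : B → Bool) (f : A → List B) (xs : List A) →
                    count q (concatMap f xs) ≡ sum (map (count q ∘ f) xs)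
  count-concatMap q f []       = refl
  count-concatMap q f (x ∷ xs) =
    trans (count-++ q (f x) (concatMap f xs)) (cong (count q (f x) +_) (count-concatMap q f xs))

  sum-map-concatMap : {A B : Set} (g : B → ℕ) (f : A → List B) (xs : List A) →
                      sum (map g (concatMap f xs)) ≡ sum (map (λ x → sum (map g (f x))) xs)
  sum-map-concatMap g f []       = refl
  sum-map-concatMap g f (x ∷ xs) = begin
    sum (map g (f x ++ concatMap f xs))                  ≡⟨ cong sum (map-++ g (f x) (concatMap f xs)) ⟩
    sum (map g (f x) ++ map g (concatMap f xs))          ≡⟨ sum-++ (map g (f x)) _ ⟩
    sum (map g (f x)) + sum (map g (concatMap f xs))     ≡⟨ cong (sum (map g (f x)) +_) (sum-map-concatMap g f xs) ⟩
    sum (map g (f x)) + sum (map (λ x → sum (map g (f x))) xs) ∎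

  sum-map-cong : {A : Set} {g h : A → ℕ} → (∀ x → g x ≡ h x) → (xs : List A) →
                 sum (map g xs) ≡ sum (map h xs)
  sum-map-cong e []       = refl
  sum-map-cong e (x ∷ xs) = cong₂ _+_ (e x) (sum-map-cong e xs)

  sumBelow : ℕ → (ℕ → ℕ) → ℕ
  sumBelow zero    f = 0
  sumBelow (suc n) f = f 0 + sumBelow n (f ∘ suc)

  syntax sumBelow n (λ i → e) = ∑[ i < n ] e

  sumBelow-suc : (n : ℕ) (f : ℕ → ℕ) → sumBelow (suc n) f ≡ sumBelow n f + f n
  sumBelow-suc zero    f = +-identityʳ (f 0)
  sumBelow-suc (suc n) f =
    trans (cong (f 0 +_) (sumBelow-suc n (f ∘ suc))) (sym (+-assoc (f 0) _ _))

  sumBelow-cong : (n : ℕ) {f g : ℕ → ℕ} → (∀ i → i < n → f i ≡ g i) → sumBelow n f ≡ sumBelow n g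
  sumBelow-cong zero    e = refl
  sumBelow-cong (suc n) e = cong₂ _+_ (e 0 (s≤s z≤n)) (sumBelow-cong n (λ i i<n → e (suc i) (s≤s i<n)))

  sumBelow-zero : (n : ℕ) → sumBelow n (λ _ → 0) ≡ 0
  sumBelow-zero zero    = refl
  sumBelow-zero (suc n) = sumBelow-zero n

  sumBelow-truncate : {b : ℕ} (n : ℕ) (f : ℕ → ℕ) → (∀ i → b ≤ i → f i ≡ 0) → b ≤ n →
                      sumBelow n f ≡ sumBelow b f
  sumBelow-truncate zero    f e z≤n = refl
  sumBelow-truncate {b} (suc n) f e b≤1+n with b ≟ suc n
  ... | yes refl = refl
  ... | no  b≢   = begin
    sumBelow (suc n) f  ≡⟨ sumBelow-suc n f ⟩
    sumBelow n f + f n  ≡⟨ cong₂ _+_ (sumBelow-truncate n f e b≤n) (e n b≤n) ⟩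
    sumBelow b f + 0    ≡⟨ +-identityʳ _ ⟩
    sumBelow b f        ∎
    where b≤n = ≤-pred (≤∧≢⇒< b≤1+n b≢)

  sum-map-applyUpTo : (g f : ℕ → ℕ) (n : ℕ) → sum (map g (applyUpTo f n)) ≡ sumBelow n (g ∘ f)
  sum-map-applyUpTo g f zero    = refl
  sum-map-applyUpTo g f (suc n) = cong (g (f 0) +_) (sum-map-applyUpTo g (f ∘ suc) n)

  sum-map-oneTo : (g : ℕ → ℕ) (n : ℕ) → sum (map g (oneTo n)) ≡ ∑[ i < n ] g (suc i)
  sum-map-oneTo g n = trans (cong sum (sym (map-∘ (applyUpTo _ n)))) (sum-map-applyUpTo (g ∘ suc) _ n)

  count-listsUpTo : {A : Set} (q : List A → Bool) (l : ℕ) (xs : List A) →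
    count q (listsUpTo (suc l) xs) ≡ 𝟙 (q []) + sum (map (λ x → count (q ∘ (x ∷_)) (listsUpTo l xs)) xs)
  count-listsUpTo q l xs = begin
    count q (listsUpTo (suc l) xs)
      ≡⟨ count-∷ q [] _ ⟩
    𝟙 (q []) + count q (concatMap (λ x → map (x ∷_) (listsUpTo l xs)) xs)
      ≡⟨ cong (𝟙 (q []) +_) (count-concatMap q _ xs) ⟩
    𝟙 (q []) + sum (map (λ x → count q (map (x ∷_) (listsUpTo l xs))) xs)
      ≡⟨ cong (𝟙 (q []) +_) (sum-map-cong (λ x → count-map q (x ∷_) (listsUpTo l xs)) xs) ⟩
    𝟙 (q []) + sum (map (λ x → count (q ∘ (x ∷_)) (listsUpTo l xs)) xs) ∎

module Partitions where

  open Comparisons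
  open Counting
  open import Data.Nat using (ℕ; zero; suc; _+_; _∸_; _≤_; _<_; _≤ᵇ_; _≡ᵇ_; s≤s)
  open import Data.Nat.Properties using (+-assoc; +-identityʳ; ≤-trans; ≤-refl; m∸n≤m)
  open import Data.Nat.ListAction using (sum)
  open import Data.Bool using (Bool; true; false; _∧_; if_then_else_)
  open import Data.Bool.Properties using (∧-assoc; ∧-idem)
  open import Data.Bool.Solver using (module ∨-∧-Solver)
  open import Data.List using (List; []; _∷_; map)
  open import Relation.Binary.PropositionalEquality
  open ≡-Reasoning

  headAtMost : ℕ → List ℕ → Bool
  headAtMost b []      = true
  headAtMost b (y ∷ _) = y ≤ᵇ b

  isBoundedPartitionOf : ℕ → ℕ → List ℕ → Bool
  isBoundedPartitionOf b s ys = headAtMost b ys ∧ isPartitionOf s ys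

  nonincreasing-∷ : (x : ℕ) (ys : List ℕ) → nonincreasing (x ∷ ys) ≡ headAtMost x ys ∧ nonincreasing ys
  nonincreasing-∷ x []      = refl
  nonincreasing-∷ x (y ∷ ys) = refl

  isPartitionOf-∷ : (s x : ℕ) (ys : List ℕ) →
                    isPartitionOf s (x ∷ ys) ≡ (x ≤ᵇ s) ∧ isBoundedPartitionOf x (s ∸ x) ys
  isPartitionOf-∷ s x ys =
    trans (cong₂ _∧_ (nonincreasing-∷ x ys) (+-≡ᵇ x (sum ys) s))
          (rearrange (headAtMost x ys) (nonincreasing ys) (x ≤ᵇ s) (sum ys ≡ᵇ s ∸ x))
    where
    open ∨-∧-Solver
    rearrange : ∀ h n l e → (h ∧ n) ∧ (l ∧ e) ≡ l ∧ (h ∧ (n ∧ e))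
    rearrange = solve 4 (λ h n l e → (h :* n) :* (l :* e) := l :* (h :* (n :* e))) refl

  isBoundedPartitionOf-∷ : (b s x : ℕ) (ys : List ℕ) → isBoundedPartitionOf b s (x ∷ ys)
                           ≡ (x ≤ᵇ b) ∧ ((x ≤ᵇ s) ∧ isBoundedPartitionOf x (s ∸ x) ys)
  isBoundedPartitionOf-∷ b s x ys = cong ((x ≤ᵇ b) ∧_) (isPartitionOf-∷ s x ys)

  isPartitionOf-bounded : (s : ℕ) (ys : List ℕ) → isPartitionOf s ys ≡ isBoundedPartitionOf s s ys
  isPartitionOf-bounded s []       = refl
  isPartitionOf-bounded s (y ∷ ys) = begin
    isPartitionOf s (y ∷ ys)              ≡⟨ isPartitionOf-∷ s y ys ⟩
    (y ≤ᵇ s) ∧ r                          ≡⟨ cong (_∧ r) (∧-idem (y ≤ᵇ s)) ⟨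
    ((y ≤ᵇ s) ∧ (y ≤ᵇ s)) ∧ r             ≡⟨ ∧-assoc (y ≤ᵇ s) _ r ⟩
    (y ≤ᵇ s) ∧ ((y ≤ᵇ s) ∧ r)             ≡⟨ cong ((y ≤ᵇ s) ∧_) (isPartitionOf-∷ s y ys) ⟨
    isBoundedPartitionOf s s (y ∷ ys)     ∎
    where r = isBoundedPartitionOf y (s ∸ y) ys

  -- pBounded l b s counts the partitions of s into at most l parts, each at most b,
  -- by the size suc i of the largest part; l is what makes the recursion structural.
  pBounded : ℕ → ℕ → ℕ → ℕ
  pBounded zero    b s = 𝟙 (0 ≡ᵇ s)
  pBounded (suc l) b s = 𝟙 (0 ≡ᵇ s) + ∑[ i < b ] (if suc i ≤ᵇ s then pBounded l (suc i) (s ∸ suc i) else 0)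

  count-isBoundedPartitionOf : (n l b s : ℕ) → b ≤ n →
    count (isBoundedPartitionOf b s) (listsUpTo l (oneTo n)) ≡ pBounded l b s
  count-isBoundedPartitionOf n zero    b s b≤n = trans (count-∷ (isBoundedPartitionOf b s) [] []) (+-identityʳ _)
  count-isBoundedPartitionOf n (suc l) b s b≤n = begin
    count (isBoundedPartitionOf b s) (listsUpTo (suc l) (oneTo n))
      ≡⟨ count-listsUpTo (isBoundedPartitionOf b s) l (oneTo n) ⟩
    𝟙 (0 ≡ᵇ s) + sum (map (λ x → count (λ ys → isBoundedPartitionOf b s (x ∷ ys)) lists) (oneTo n))
      ≡⟨ cong (𝟙 (0 ≡ᵇ s) +_) (trans (sum-map-oneTo _ n) (sumBelow-cong n (λ i _ → largest≡ i))) ⟩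
    𝟙 (0 ≡ᵇ s) + sumBelow n largest
      ≡⟨ cong (𝟙 (0 ≡ᵇ s) +_) (trans (sumBelow-truncate n largest vanish b≤n) (sumBelow-cong b agree)) ⟩
    pBounded (suc l) b s ∎
    where
    lists = listsUpTo l (oneTo n)
    largest : ℕ → ℕ
    largest i = if suc i ≤ᵇ b then (if suc i ≤ᵇ s then count (isBoundedPartitionOf (suc i) (s ∸ suc i)) lists else 0) else 0
    largest≡ : ∀ i → count (λ ys → isBoundedPartitionOf b s (suc i ∷ ys)) lists ≡ largest i
    largest≡ i = begin
      count (λ ys → isBoundedPartitionOf b s (suc i ∷ ys)) lists
        ≡⟨ count-cong (isBoundedPartitionOf-∷ b s (suc i)) lists ⟩
      count (λ ys → (suc i ≤ᵇ b) ∧ ((suc i ≤ᵇ s) ∧ isBoundedPartitionOf (suc i) (s ∸ suc i) ys)) lists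
        ≡⟨ count-guard (suc i ≤ᵇ b) _ lists ⟩
      (if suc i ≤ᵇ b then count (λ ys → (suc i ≤ᵇ s) ∧ isBoundedPartitionOf (suc i) (s ∸ suc i) ys) lists else 0)
        ≡⟨ cong (λ c → if suc i ≤ᵇ b then c else 0) (count-guard (suc i ≤ᵇ s) _ lists) ⟩
      largest i ∎
    vanish : ∀ i → b ≤ i → largest i ≡ 0
    vanish i b≤i rewrite ≤ᵇ-false (s≤s b≤i) = refl
    agree : ∀ i → i < b → largest i ≡ (if suc i ≤ᵇ s then pBounded l (suc i) (s ∸ suc i) else 0)
    agree i i<b rewrite ≤ᵇ-true i<b with suc i ≤ᵇ s
    ... | true  = count-isBoundedPartitionOf n l (suc i) (s ∸ suc i) (≤-trans i<b b≤n)
    ... | false = refl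

  -- Once l ≥ s the bound on the number of parts is vacuous.
  pBounded-fuel : {l l′ : ℕ} (b s : ℕ) → s ≤ l → s ≤ l′ → pBounded l b s ≡ pBounded l′ b s
  pBounded-fuel {zero}  {zero}   b s _ _ = refl
  pBounded-fuel {zero}  {suc l′} b zero _ _ = cong suc (sym (sumBelow-zero b))
  pBounded-fuel {suc l} {zero}   b zero _ _ = cong suc (sumBelow-zero b)
  pBounded-fuel {suc l} {suc l′} b s s≤1+l s≤1+l′ =
    cong (𝟙 (0 ≡ᵇ s) +_) (sumBelow-cong b (λ i _ → remainder i))
    where
    remainder : ∀ i → (if suc i ≤ᵇ s then pBounded l (suc i) (s ∸ suc i) else 0)
                    ≡ (if suc i ≤ᵇ s then pBounded l′ (suc i) (s ∸ suc i) else 0)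
    remainder i with suc i ≤ᵇ s
    ... | false = refl
    ... | true  = pBounded-fuel (suc i) (s ∸ suc i) (∸-suc-≤ i s≤1+l) (∸-suc-≤ i s≤1+l′)

  pAtMost : ℕ → ℕ → ℕ
  pAtMost m s = pBounded s m s

  pAtMost-suc : (m s : ℕ) →
    pAtMost (suc m) s ≡ pAtMost m s + (if suc m ≤ᵇ s then pAtMost (suc m) (s ∸ suc m) else 0)
  pAtMost-suc m zero    = refl
  pAtMost-suc m (suc l) = begin
    𝟙 false + sumBelow (suc m) largest        ≡⟨ cong (𝟙 false +_) (sumBelow-suc m largest) ⟩
    𝟙 false + (sumBelow m largest + largest m) ≡⟨ +-assoc (𝟙 false) (sumBelow m largest) (largest m) ⟨
    pAtMost m (suc l) + largest m              ≡⟨ cong (pAtMost m (suc l) +_) largest-m ⟩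
    pAtMost m (suc l) + (if suc m ≤ᵇ suc l then pAtMost (suc m) (suc l ∸ suc m) else 0) ∎
    where
    largest : ℕ → ℕ
    largest i = if suc i ≤ᵇ suc l then pBounded l (suc i) (suc l ∸ suc i) else 0
    largest-m : largest m ≡ (if suc m ≤ᵇ suc l then pAtMost (suc m) (suc l ∸ suc m) else 0)
    largest-m with suc m ≤ᵇ suc l
    ... | false = refl
    ... | true  = pBounded-fuel (suc m) (l ∸ m) (m∸n≤m l m) ≤-refl

  pAtMost-large : {m s : ℕ} → s ≤ m → pAtMost m s ≡ pAtMost s s
  pAtMost-large {m} {zero}  _   = refl
  pAtMost-large {m} {suc l} s≤m = cong (𝟙 false +_) (sumBelow-truncate m _ vanish s≤m)
    where
    vanish : ∀ i → suc l ≤ i → (if suc i ≤ᵇ suc l then pBounded l (suc i) (suc l ∸ suc i) else 0) ≡ 0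
    vanish i s≤i rewrite ≤ᵇ-false (s≤s s≤i) = refl

  p≡pAtMost : {m s : ℕ} → s ≤ m → p s ≡ pAtMost m s
  p≡pAtMost {m} {s} s≤m = begin
    count (isPartitionOf s) (listsUpTo s (oneTo s))           ≡⟨ count-cong (isPartitionOf-bounded s) (listsUpTo s (oneTo s)) ⟩
    count (isBoundedPartitionOf s s) (listsUpTo s (oneTo s))  ≡⟨ count-isBoundedPartitionOf s s s s ≤-refl ⟩
    pAtMost s s                                               ≡⟨ pAtMost-large s≤m ⟨
    pAtMost m s                                               ∎

module OddOverpartitions where

  open Comparisons
  open Counting
  open import Data.Nat using (ℕ; zero; suc; _+_; _*_; _∸_; _≤_; _<_; _≤ᵇ_; _≡ᵇ_; s≤s)
  open import Data.Nat.Properties using (+-assoc; +-identityʳ; ≤-trans; ≤-refl; n≤1+n; m∸n≤m)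
  open import Data.Nat.ListAction using (sum)
  open import Data.Bool using (Bool; true; false; _∧_; _∨_; not; if_then_else_)
  open import Data.Bool.Properties using (∧-assoc)
  open import Data.Bool.Solver using (module ∨-∧-Solver)
  open import Data.List using (List; []; _∷_; map)
  open import Data.Product using (_×_; _,_; proj₁)
  open import Function using (_∘_)
  open import Relation.Binary.PropositionalEquality
  open ≡-Reasoning

  mayFollow : ℕ → ℕ → Bool → Bool
  mayFollow a x c = (x ≤ᵇ a) ∧ (not (x ≡ᵇ a) ∨ not c)

  headMayFollow : ℕ → List (ℕ × Bool) → Bool
  headMayFollow a []            = true
  headMayFollow a ((x , c) ∷ _) = mayFollow a x c

  isBoundedOddOverpartitionOf : ℕ → ℕ → List (ℕ × Bool) → Bool
  isBoundedOddOverpartitionOf a s ys = headMayFollow a ys ∧ isOddOverpartitionOf s ys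

  overOK-∷ : (x : ℕ) (c : Bool) (ys : List (ℕ × Bool)) → overOK ((x , c) ∷ ys) ≡ headMayFollow x ys ∧ overOK ys
  overOK-∷ x c []             = refl
  overOK-∷ x c ((y , d) ∷ ys) = sym (∧-assoc (y ≤ᵇ x) _ _)

  isOddOverpartitionOf-∷ : (s x : ℕ) (c : Bool) (ys : List (ℕ × Bool)) → isOddOverpartitionOf s ((x , c) ∷ ys)
                           ≡ ((x ≤ᵇ s) ∧ isOdd x) ∧ isBoundedOddOverpartitionOf x (s ∸ x) ys
  isOddOverpartitionOf-∷ s x c ys =
    trans (cong₂ (λ o e → o ∧ ((isOdd x ∧ allOdd ys) ∧ e)) (overOK-∷ x c ys) (+-≡ᵇ x (sum (map proj₁ ys)) s))
          (rearrange (headMayFollow x ys) (overOK ys) (isOdd x) (allOdd ys) (x ≤ᵇ s) (sum (map proj₁ ys) ≡ᵇ s ∸ x))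
    where
    open ∨-∧-Solver
    rearrange : ∀ h o i a l e → (h ∧ o) ∧ ((i ∧ a) ∧ (l ∧ e)) ≡ (l ∧ i) ∧ (h ∧ (o ∧ (a ∧ e)))
    rearrange = solve 6 (λ h o i a l e → (h :* o) :* ((i :* a) :* (l :* e)) := (l :* i) :* (h :* (o :* (a :* e)))) refl

  isBoundedOddOverpartitionOf-∷ : (a s x : ℕ) (c : Bool) (ys : List (ℕ × Bool)) →
    isBoundedOddOverpartitionOf a s ((x , c) ∷ ys)
    ≡ (mayFollow a x c ∧ ((x ≤ᵇ s) ∧ isOdd x)) ∧ isBoundedOddOverpartitionOf x (s ∸ x) ys
  isBoundedOddOverpartitionOf-∷ a s x c ys =
    trans (cong (mayFollow a x c ∧_) (isOddOverpartitionOf-∷ s x c ys)) (sym (∧-assoc (mayFollow a x c) _ _))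

  count-listsUpTo-pairsOneTo : (q : List (ℕ × Bool) → Bool) (l n : ℕ) →
    count q (listsUpTo (suc l) (pairsOneTo n))
    ≡ 𝟙 (q []) + ∑[ i < n ] (count (q ∘ ((suc i , false) ∷_)) (listsUpTo l (pairsOneTo n))
                             + count (q ∘ ((suc i , true) ∷_)) (listsUpTo l (pairsOneTo n)))
  count-listsUpTo-pairsOneTo q l n =
    trans (count-listsUpTo q l (pairsOneTo n)) (cong (𝟙 (q []) +_)
      (trans (sum-map-concatMap first _ (oneTo n))
      (trans (sum-map-oneTo _ n)
             (sumBelow-cong n (λ i _ → cong (first (suc i , false) +_) (+-identityʳ _))))))
    where
    first : ℕ × Bool → ℕ
    first x = count (q ∘ (x ∷_)) (listsUpTo l (pairsOneTo n))

  double-if : (g : Bool) (x : ℕ) → (if g then x else 0) + (if g then x else 0) ≡ (if g then 2 * x else 0)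
  double-if true  x = cong (x +_) (sym (+-identityʳ x))
  double-if false x = refl

  oddFirstParts : (ℕ → ℕ → ℕ) → ℕ → ℕ → ℕ
  oddFirstParts w m s = ∑[ i < m ] (if (suc i ≤ᵇ s) ∧ isOdd (suc i) then 2 * w i (s ∸ suc i) else 0)

  -- ovBounded l m s: odd overpartitions of s into at most l parts, each at most m.
  -- ovFollowing l a s: the same with parts at most suc a, and suc a never overlined,
  -- i.e. the possible continuations after a non-overlined part suc a.
  ovBounded ovFollowing : ℕ → ℕ → ℕ → ℕ
  ovBounded zero    m s = 𝟙 (0 ≡ᵇ s)
  ovBounded (suc l) m s = 𝟙 (0 ≡ᵇ s) + oddFirstParts (ovFollowing l) m s
  ovFollowing zero    a s = 𝟙 (0 ≡ᵇ s)
  ovFollowing (suc l) a s =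
    ovBounded (suc l) a s + (if (suc a ≤ᵇ s) ∧ isOdd (suc a) then ovFollowing l a (s ∸ suc a) else 0)

  count-first-part : (q : List (ℕ × Bool) → Bool) (g : Bool) (x s : ℕ) (c : Bool) (lists : List (List (ℕ × Bool))) →
    (∀ ys → q ((x , c) ∷ ys) ≡ g ∧ isBoundedOddOverpartitionOf x (s ∸ x) ys) →
    count (q ∘ ((x , c) ∷_)) lists ≡ (if g then count (isBoundedOddOverpartitionOf x (s ∸ x)) lists else 0)
  count-first-part q g x s c lists q-∷ = trans (count-cong q-∷ lists) (count-guard g _ lists)

  count-isBoundedOddOverpartitionOf : (n l a s : ℕ) → suc a ≤ n →
    count (isBoundedOddOverpartitionOf (suc a) s) (listsUpTo l (pairsOneTo n)) ≡ ovFollowing l a s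
  count-isBoundedOddOverpartitionOf n zero    a s _ =
    trans (count-∷ (isBoundedOddOverpartitionOf (suc a) s) [] []) (+-identityʳ _)
  count-isBoundedOddOverpartitionOf n (suc l) a s a<n = begin
    count (isBoundedOddOverpartitionOf (suc a) s) (listsUpTo (suc l) (pairsOneTo n))
      ≡⟨ count-listsUpTo-pairsOneTo (isBoundedOddOverpartitionOf (suc a) s) l n ⟩
    𝟙 (0 ≡ᵇ s) + sumBelow n (λ i → first i false + first i true)
      ≡⟨ cong (𝟙 (0 ≡ᵇ s) +_) (sumBelow-truncate n _ vanish a<n) ⟩
    𝟙 (0 ≡ᵇ s) + sumBelow (suc a) (λ i → first i false + first i true)
      ≡⟨ cong (𝟙 (0 ≡ᵇ s) +_) (sumBelow-suc a _) ⟩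
    𝟙 (0 ≡ᵇ s) + (sumBelow a (λ i → first i false + first i true) + (first a false + first a true))
      ≡⟨ +-assoc (𝟙 (0 ≡ᵇ s)) _ _ ⟨
    (𝟙 (0 ≡ᵇ s) + sumBelow a (λ i → first i false + first i true)) + (first a false + first a true)
      ≡⟨ cong₂ (λ u v → (𝟙 (0 ≡ᵇ s) + u) + v) (sumBelow-cong a smaller) equal ⟩
    ovFollowing (suc l) a s ∎
    where
    lists = listsUpTo l (pairsOneTo n)
    fits : ℕ → Bool
    fits i = (suc i ≤ᵇ s) ∧ isOdd (suc i)
    first : ℕ → Bool → ℕ
    first i c = count (λ ys → isBoundedOddOverpartitionOf (suc a) s ((suc i , c) ∷ ys)) lists
    rest : ℕ → ℕ
    rest i = count (isBoundedOddOverpartitionOf (suc i) (s ∸ suc i)) lists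
    rest≡ : ∀ i → i ≤ a → rest i ≡ ovFollowing l i (s ∸ suc i)
    rest≡ i i≤a = count-isBoundedOddOverpartitionOf n l i (s ∸ suc i) (≤-trans (s≤s i≤a) a<n)
    first≡ : ∀ i c → first i c ≡ (if mayFollow (suc a) (suc i) c ∧ fits i then rest i else 0)
    first≡ i c = count-first-part (isBoundedOddOverpartitionOf (suc a) s) _ (suc i) s c lists
                   (isBoundedOddOverpartitionOf-∷ (suc a) s (suc i) c)
    vanish : ∀ i → suc a ≤ i → first i false + first i true ≡ 0
    vanish i a<i rewrite first≡ i false | first≡ i true | ≤ᵇ-false (s≤s a<i) = refl
    smaller : ∀ i → i < a → first i false + first i true ≡ (if fits i then 2 * ovFollowing l i (s ∸ suc i) else 0)
    smaller i i<a rewrite first≡ i false | first≡ i true | ≤ᵇ-true (≤-trans i<a (n≤1+n a)) | <⇒≡ᵇ-false i<a =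
      trans (double-if (fits i) (rest i)) (cong (λ k → if fits i then 2 * k else 0) (rest≡ i (≤-trans (n≤1+n i) i<a)))
    equal : first a false + first a true ≡ (if fits a then ovFollowing l a (s ∸ suc a) else 0)
    equal rewrite first≡ a false | first≡ a true | ≤ᵇ-true (≤-refl {suc a}) | ≡ᵇ-refl a =
      trans (+-identityʳ _) (cong (λ k → if fits a then k else 0) (rest≡ a ≤-refl))

  pbarO≡ovBounded : (n : ℕ) → pbarO n ≡ ovBounded n n n
  pbarO≡ovBounded zero    = refl
  pbarO≡ovBounded n@(suc l) =
    trans (count-listsUpTo-pairsOneTo (isOddOverpartitionOf n) l n)
          (cong (𝟙 (0 ≡ᵇ n) +_) (sumBelow-cong n parts))
    where
    lists = listsUpTo l (pairsOneTo n)
    fits : ℕ → Bool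
    fits i = (suc i ≤ᵇ n) ∧ isOdd (suc i)
    first≡ : ∀ i c → count (λ ys → isOddOverpartitionOf n ((suc i , c) ∷ ys)) lists
             ≡ (if fits i then count (isBoundedOddOverpartitionOf (suc i) (n ∸ suc i)) lists else 0)
    first≡ i c = count-first-part (isOddOverpartitionOf n) (fits i) (suc i) n c lists (isOddOverpartitionOf-∷ n (suc i) c)
    parts : ∀ i → i < n →
      count (λ ys → isOddOverpartitionOf n ((suc i , false) ∷ ys)) lists
      + count (λ ys → isOddOverpartitionOf n ((suc i , true) ∷ ys)) lists
      ≡ (if fits i then 2 * ovFollowing l i (n ∸ suc i) else 0)
    parts i i<n rewrite first≡ i false | first≡ i true =
      trans (double-if (fits i) _)
            (cong (λ k → if fits i then 2 * k else 0) (count-isBoundedOddOverpartitionOf n l i (n ∸ suc i) i<n))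

  oddFirstParts-cong : (w w′ : ℕ → ℕ → ℕ) (m s : ℕ) → (∀ i → w i (s ∸ suc i) ≡ w′ i (s ∸ suc i)) →
                       oddFirstParts w m s ≡ oddFirstParts w′ m s
  oddFirstParts-cong w w′ m s e =
    sumBelow-cong m (λ i _ → cong (λ k → if (suc i ≤ᵇ s) ∧ isOdd (suc i) then 2 * k else 0) (e i))

  ovBounded-fuel : {l l′ : ℕ} (m s : ℕ) → s ≤ l → s ≤ l′ → ovBounded l m s ≡ ovBounded l′ m s
  ovFollowing-fuel : {l l′ : ℕ} (a s : ℕ) → s ≤ l → s ≤ l′ → ovFollowing l a s ≡ ovFollowing l′ a s

  ovBounded-fuel {zero}  {zero}   m s    _ _ = refl
  ovBounded-fuel {zero}  {suc l′} m zero _ _ = cong suc (sym (sumBelow-zero m))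
  ovBounded-fuel {suc l} {zero}   m zero _ _ = cong suc (sumBelow-zero m)
  ovBounded-fuel {suc l} {suc l′} m s s≤1+l s≤1+l′ = cong (𝟙 (0 ≡ᵇ s) +_) (oddFirstParts-cong (ovFollowing l) (ovFollowing l′) m s
    (λ i → ovFollowing-fuel i (s ∸ suc i) (∸-suc-≤ i s≤1+l) (∸-suc-≤ i s≤1+l′)))

  ovFollowing-fuel {zero}  {zero}   a s    _ _ = refl
  ovFollowing-fuel {zero}  {suc l′} a zero _ _ = cong suc (sym (trans (+-identityʳ _) (sumBelow-zero a)))
  ovFollowing-fuel {suc l} {zero}   a zero _ _ = cong suc (trans (+-identityʳ _) (sumBelow-zero a))
  ovFollowing-fuel {suc l} {suc l′} a s s≤1+l s≤1+l′ = cong₂ _+_ (ovBounded-fuel a s s≤1+l s≤1+l′)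
    (cong (λ k → if (suc a ≤ᵇ s) ∧ isOdd (suc a) then k else 0)
          (ovFollowing-fuel a (s ∸ suc a) (∸-suc-≤ a s≤1+l) (∸-suc-≤ a s≤1+l′)))

  ovAtMost ovFollowingAtMost : ℕ → ℕ → ℕ
  ovAtMost          m s = ovBounded s m s
  ovFollowingAtMost a s = ovFollowing s a s

  ovFollowingAtMost-eq : (a s : ℕ) → ovFollowingAtMost a s ≡ ovAtMost a s
    + (if (suc a ≤ᵇ s) ∧ isOdd (suc a) then ovFollowingAtMost a (s ∸ suc a) else 0)
  ovFollowingAtMost-eq a zero    = refl
  ovFollowingAtMost-eq a (suc l) = cong (ovAtMost a (suc l) +_)
    (cong (λ k → if (suc a ≤ᵇ suc l) ∧ isOdd (suc a) then k else 0) (ovFollowing-fuel a (l ∸ a) (m∸n≤m l a) ≤-refl))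

  ovAtMost-suc : (m s : ℕ) → ovAtMost (suc m) s ≡ ovAtMost m s
    + (if (suc m ≤ᵇ s) ∧ isOdd (suc m) then 2 * ovFollowingAtMost m (s ∸ suc m) else 0)
  ovAtMost-suc m zero    = refl
  ovAtMost-suc m (suc l) = begin
    𝟙 false + sumBelow (suc m) largest         ≡⟨ cong (𝟙 false +_) (sumBelow-suc m largest) ⟩
    𝟙 false + (sumBelow m largest + largest m) ≡⟨ +-assoc (𝟙 false) (sumBelow m largest) (largest m) ⟨
    ovAtMost m (suc l) + largest m             ≡⟨ cong (ovAtMost m (suc l) +_) largest-m ⟩
    ovAtMost m (suc l) + (if (suc m ≤ᵇ suc l) ∧ isOdd (suc m) then 2 * ovFollowingAtMost m (l ∸ m) else 0) ∎
    where
    largest : ℕ → ℕ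
    largest i = if (suc i ≤ᵇ suc l) ∧ isOdd (suc i) then 2 * ovFollowing l i (l ∸ i) else 0
    largest-m : largest m ≡ (if (suc m ≤ᵇ suc l) ∧ isOdd (suc m) then 2 * ovFollowingAtMost m (l ∸ m) else 0)
    largest-m = cong (λ k → if (suc m ≤ᵇ suc l) ∧ isOdd (suc m) then 2 * k else 0)
                     (ovFollowing-fuel m (l ∸ m) (m∸n≤m l m) ≤-refl)

  ovAtMost-large : {m s : ℕ} → s ≤ m → ovAtMost m s ≡ ovAtMost s s
  ovAtMost-large {m} {zero}  _   = refl
  ovAtMost-large {m} {suc l} s≤m = cong (𝟙 false +_) (sumBelow-truncate m _ vanish s≤m)
    where
    vanish : ∀ i → suc l ≤ i → (if (suc i ≤ᵇ suc l) ∧ isOdd (suc i) then 2 * ovFollowing l i (l ∸ i) else 0) ≡ 0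
    vanish i s≤i rewrite ≤ᵇ-false (s≤s s≤i) = refl

  pbarO≡ovAtMost : {m n : ℕ} → n ≤ m → pbarO n ≡ ovAtMost m n
  pbarO≡ovAtMost {n = n} n≤m = trans (pbarO≡ovBounded n) (sym (ovAtMost-large n≤m))

module Signs where

  open import Data.Nat as ℕ using (ℕ; zero; suc)
  open import Data.Nat.Properties using (+-comm; +-suc)
  open import Function using (_∘_)
  open import Data.Nat.DivMod using (_%_; [m+n]%n≡m%n)
  open import Data.Integer using (ℤ; _*_; -_; 1ℤ; -1ℤ)
  open import Data.Integer.Properties using (neg-involutive; *-identityˡ; neg-distribˡ-*; *-comm; -1*i≡-i)
  open import Data.Bool using (if_then_else_)
  open import Relation.Binary.PropositionalEquality
  open ≡-Reasoning

  neg1^ : ℕ → ℤ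
  neg1^ zero    = 1ℤ
  neg1^ (suc n) = - neg1^ n

  isOdd-2+ : (a : ℕ) → isOdd (2 ℕ.+ a) ≡ isOdd a
  isOdd-2+ a = cong (λ r → r ℕ.≡ᵇ 1) (trans (cong (_% 2) (+-comm 2 a)) ([m+n]%n≡m%n a 2))

  neg1^-isOdd : (a : ℕ) → neg1^ a ≡ (if isOdd a then -1ℤ else 1ℤ)
  neg1^-isOdd zero          = refl
  neg1^-isOdd (suc zero)    = refl
  neg1^-isOdd (suc (suc a)) = trans (neg-involutive (neg1^ a))
    (trans (neg1^-isOdd a) (cong (λ b → if b then -1ℤ else 1ℤ) (sym (isOdd-2+ a))))

  neg1^-+ : (a b : ℕ) → neg1^ (a ℕ.+ b) ≡ neg1^ a * neg1^ b
  neg1^-+ zero    b = sym (*-identityˡ (neg1^ b))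
  neg1^-+ (suc a) b = trans (cong -_ (neg1^-+ a b)) (neg-distribˡ-* (neg1^ a) (neg1^ b))

  neg1^-2* : (y : ℕ) → neg1^ (2 ℕ.* y) ≡ 1ℤ
  neg1^-2* zero    = refl
  neg1^-2* (suc y) = begin
    neg1^ (2 ℕ.* suc y)                ≡⟨ cong (neg1^ ∘ suc) (+-suc y (y ℕ.+ 0)) ⟩
    neg1^ (2 ℕ.+ 2 ℕ.* y)              ≡⟨ neg-involutive _ ⟩
    neg1^ (2 ℕ.* y)                    ≡⟨ neg1^-2* y ⟩
    1ℤ                                 ∎

  neg1^-+odd : (x y : ℕ) → neg1^ (x ℕ.+ suc (2 ℕ.* y)) ≡ - neg1^ x
  neg1^-+odd x y = begin
    neg1^ (x ℕ.+ suc (2 ℕ.* y))      ≡⟨ neg1^-+ x (suc (2 ℕ.* y)) ⟩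
    neg1^ x * - neg1^ (2 ℕ.* y)      ≡⟨ cong (λ z → neg1^ x * - z) (neg1^-2* y) ⟩
    neg1^ x * -1ℤ                    ≡⟨ *-comm (neg1^ x) -1ℤ ⟩
    -1ℤ * neg1^ x                    ≡⟨ -1*i≡-i (neg1^ x) ⟩
    - neg1^ x                        ∎

module Series where

  open Signs
  open Comparisons using (1+≤ᵇ1+; ≤ᵇ-true⁻¹)
  open import Data.Nat as ℕ using (ℕ; zero; suc; _∸_; _≤_; _<_; _≤ᵇ_; z≤n; s≤s)
  open import Data.Nat.Properties using (∸-monoʳ-<)
  open import Data.Nat.Induction using (<-rec)
  open import Data.Integer using (ℤ; _+_; _*_; -_; _-_; 0ℤ; 1ℤ)
  open import Data.Integer.Properties
    using (+-identityˡ; +-identityʳ; *-identityˡ; *-zeroʳ; *-assoc; *-distribʳ-+; *-distribˡ-+; neg-distribˡ-*)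
  open import Data.Integer.Tactic.RingSolver using (solve-∀)
  open import Data.Bool using (true; false; if_then_else_)
  open import Function using (_∘_)
  open import Relation.Binary.PropositionalEquality
  open ≡-Reasoning

  Series : Set
  Series = ℕ → ℤ

  infix  4 _≈_
  infixl 6 _⊕_ _⊖_
  infixl 7 _·_ _∗_

  _≈_ : Series → Series → Set
  f ≈ g = ∀ j → f j ≡ g j

  ≈-trans : {f g h : Series} → f ≈ g → g ≈ h → f ≈ h
  ≈-trans e e′ j = trans (e j) (e′ j)

  _⊕_ _⊖_ : Series → Series → Series
  (f ⊕ g) j = f j + g j
  (f ⊖ g) j = f j - g j

  _·_ : ℤ → Series → Series
  (c · f) j = c * f j

  𝟎 𝟏 : Series
  𝟎 _       = 0ℤ
  𝟏 zero    = 1ℤ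
  𝟏 (suc _) = 0ℤ

  shift₁ : Series → Series
  shift₁ f zero    = 0ℤ
  shift₁ f (suc j) = f j

  shift : ℕ → Series → Series
  shift zero    f = f
  shift (suc a) f = shift₁ (shift a f)

  shift₁-cong : {f g : Series} → f ≈ g → shift₁ f ≈ shift₁ g
  shift₁-cong e zero    = refl
  shift₁-cong e (suc j) = e j

  shift-cong : (a : ℕ) {f g : Series} → f ≈ g → shift a f ≈ shift a g
  shift-cong zero    e = e
  shift-cong (suc a) e = shift₁-cong (shift-cong a e)

  shift-⊖ : (a : ℕ) (f g : Series) → shift a (f ⊖ g) ≈ shift a f ⊖ shift a g
  shift-⊖ zero    f g j       = refl
  shift-⊖ (suc a) f g zero    = refl
  shift-⊖ (suc a) f g (suc j) = shift-⊖ a f g j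

  shift-shift : (a b : ℕ) (f : Series) → shift a (shift b f) ≈ shift (a ℕ.+ b) f
  shift-shift zero    b f j = refl
  shift-shift (suc a) b f   = shift₁-cong (shift-shift a b f)

  shift-≡ : {a b : ℕ} → a ≡ b → (f : Series) → shift a f ≈ shift b f
  shift-≡ refl f j = refl

  shift-· : (a : ℕ) (c : ℤ) (f : Series) → shift a (c · f) ≈ c · shift a f
  shift-· zero    c f j       = refl
  shift-· (suc a) c f zero    = sym (*-zeroʳ c)
  shift-· (suc a) c f (suc j) = shift-· a c f j

  shift-below : (a : ℕ) (f : Series) {j : ℕ} → j < a → shift a f j ≡ 0ℤ
  shift-below (suc a) f {zero}  _         = refl
  shift-below (suc a) f {suc j} (s≤s j<a) = shift-below a f j<a

  shift-if : (a : ℕ) (f : Series) (j : ℕ) → shift a f j ≡ (if a ≤ᵇ j then f (j ∸ a) else 0ℤ)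
  shift-if zero    f j       = refl
  shift-if (suc a) f zero    = refl
  shift-if (suc a) f (suc j) =
    trans (shift-if a f j) (cong (λ b → if b then f (j ∸ a) else 0ℤ) (sym (1+≤ᵇ1+ a j)))

  shift-suc-local : (a : ℕ) {f g : Series} (s : ℕ) → (∀ {j} → j < s → f j ≡ g j) →
                    shift (suc a) f s ≡ shift (suc a) g s
  shift-suc-local a {f} {g} s e rewrite shift-if (suc a) f s | shift-if (suc a) g s with suc a ≤ᵇ s in eq
  ... | false = refl
  ... | true  = e (∸-monoʳ-< (s≤s z≤n) (≤ᵇ-true⁻¹ eq))

  -- X = Y + q^(a+1) X determines X, one coefficient at a time.
  shift-fixpoint-unique : (a : ℕ) (Y f g : Series) →
    (∀ s → f s ≡ Y s + shift (suc a) f s) → (∀ s → g s ≡ Y s + shift (suc a) g s) → f ≈ g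
  shift-fixpoint-unique a Y f g f-eq g-eq = <-rec (λ s → f s ≡ g s)
    (λ s ih → trans (f-eq s) (trans (cong (Y s +_) (shift-suc-local a s ih)) (sym (g-eq s))))

  _∗_ : Series → Series → Series
  (f ∗ g) zero    = f 0 * g 0
  (f ∗ g) (suc n) = f 0 * g (suc n) + ((f ∘ suc) ∗ g) n

  ∗-local : (n : ℕ) {f f′ : Series} (g : Series) → (∀ j → j ≤ n → f j ≡ f′ j) → (f ∗ g) n ≡ (f′ ∗ g) n
  ∗-local zero    g e = cong (_* g 0) (e 0 z≤n)
  ∗-local (suc n) g e =
    cong₂ _+_ (cong (_* g (suc n)) (e 0 z≤n)) (∗-local n g (λ j j≤n → e (suc j) (s≤s j≤n)))

  ∗-congˡ : {f f′ : Series} (g : Series) → f ≈ f′ → f ∗ g ≈ f′ ∗ g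
  ∗-congˡ g e n = ∗-local n g (λ j _ → e j)

  ∗-congʳ : (f : Series) {g g′ : Series} → g ≈ g′ → f ∗ g ≈ f ∗ g′
  ∗-congʳ f e zero    = cong (f 0 *_) (e 0)
  ∗-congʳ f e (suc n) = cong₂ _+_ (cong (f 0 *_) (e (suc n))) (∗-congʳ (f ∘ suc) e n)

  ∗-zeroˡ : (g : Series) → 𝟎 ∗ g ≈ 𝟎
  ∗-zeroˡ g zero    = refl
  ∗-zeroˡ g (suc n) = trans (+-identityˡ _) (∗-zeroˡ g n)

  ∗-identityˡ : (g : Series) → 𝟏 ∗ g ≈ g
  ∗-identityˡ g zero    = *-identityˡ (g 0)
  ∗-identityˡ g (suc n) = trans (cong₂ _+_ (*-identityˡ (g (suc n))) (∗-zeroˡ g n)) (+-identityʳ _)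

  shift-∗ : (a : ℕ) (f g : Series) → shift a f ∗ g ≈ shift a (f ∗ g)
  shift-∗ zero    f g j       = refl
  shift-∗ (suc a) f g zero    = refl
  shift-∗ (suc a) f g (suc n) = trans (+-identityˡ _) (shift-∗ a f g n)

  ∗-shift₁ : (f g : Series) → f ∗ shift₁ g ≈ shift₁ (f ∗ g)
  ∗-shift₁ f g zero          = *-zeroʳ (f 0)
  ∗-shift₁ f g (suc zero)    = trans (cong (f 0 * g 0 +_) (*-zeroʳ (f 1))) (+-identityʳ _)
  ∗-shift₁ f g (suc (suc n)) = cong (f 0 * g (suc n) +_) (∗-shift₁ (f ∘ suc) g (suc n))

  ∗-shift : (a : ℕ) (f g : Series) → f ∗ shift a g ≈ shift a (f ∗ g)
  ∗-shift zero    f g j = refl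
  ∗-shift (suc a) f g   = ≈-trans (∗-shift₁ f (shift a g)) (shift₁-cong (∗-shift a f g))

  ∗-distribʳ-⊕ : (f f′ g : Series) → (f ⊕ f′) ∗ g ≈ f ∗ g ⊕ f′ ∗ g
  ∗-distribʳ-⊕ f f′ g zero    = *-distribʳ-+ (g 0) (f 0) (f′ 0)
  ∗-distribʳ-⊕ f f′ g (suc n) =
    trans (cong ((f 0 + f′ 0) * g (suc n) +_) (∗-distribʳ-⊕ (f ∘ suc) (f′ ∘ suc) g n))
          (regroup (f 0) (f′ 0) (g (suc n)) _ _)
    where
    regroup : ∀ a b c x y → (a + b) * c + (x + y) ≡ (a * c + x) + (b * c + y)
    regroup = solve-∀

  ∗-distribˡ-⊕ : (f g g′ : Series) → f ∗ (g ⊕ g′) ≈ f ∗ g ⊕ f ∗ g′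
  ∗-distribˡ-⊕ f g g′ zero    = *-distribˡ-+ (f 0) (g 0) (g′ 0)
  ∗-distribˡ-⊕ f g g′ (suc n) =
    trans (cong (f 0 * (g (suc n) + g′ (suc n)) +_) (∗-distribˡ-⊕ (f ∘ suc) g g′ n))
          (regroup (f 0) (g (suc n)) (g′ (suc n)) _ _)
    where
    regroup : ∀ a b c x y → a * (b + c) + (x + y) ≡ (a * b + x) + (a * c + y)
    regroup = solve-∀

  ∗-distribʳ-⊖ : (f f′ g : Series) → (f ⊖ f′) ∗ g ≈ f ∗ g ⊖ f′ ∗ g
  ∗-distribʳ-⊖ f f′ g zero    = regroup (f 0) (f′ 0) (g 0)
    where
    regroup : ∀ a b c → (a - b) * c ≡ a * c - b * c
    regroup = solve-∀
  ∗-distribʳ-⊖ f f′ g (suc n) =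
    trans (cong ((f 0 - f′ 0) * g (suc n) +_) (∗-distribʳ-⊖ (f ∘ suc) (f′ ∘ suc) g n))
          (regroup (f 0) (f′ 0) (g (suc n)) _ _)
    where
    regroup : ∀ a b c x y → (a - b) * c + (x - y) ≡ (a * c + x) - (b * c + y)
    regroup = solve-∀

  ·-∗ : (k : ℤ) (f g : Series) → k · f ∗ g ≈ k · (f ∗ g)
  ·-∗ k f g zero    = *-assoc k (f 0) (g 0)
  ·-∗ k f g (suc n) =
    trans (cong ((k * f 0) * g (suc n) +_) (·-∗ k (f ∘ suc) g n)) (regroup k (f 0) (g (suc n)) _)
    where
    regroup : ∀ k a c x → (k * a) * c + k * x ≡ k * (a * c + x)
    regroup = solve-∀

  -- twist f is f(-q).
  twist : Series → Series
  twist f j = neg1^ j * f j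

  twist-𝟏 : twist 𝟏 ≈ 𝟏
  twist-𝟏 zero    = refl
  twist-𝟏 (suc j) = *-zeroʳ (neg1^ (suc j))

  twist-shift : (a : ℕ) (f : Series) → twist (shift a f) ≈ neg1^ a · shift a (twist f)
  twist-shift zero    f j       = sym (*-identityˡ _)
  twist-shift (suc a) f zero    = sym (*-zeroʳ (neg1^ (suc a)))
  twist-shift (suc a) f (suc j) = begin
    - neg1^ j * shift a f j             ≡⟨ neg-distribˡ-* (neg1^ j) (shift a f j) ⟨
    - (neg1^ j * shift a f j)           ≡⟨ cong -_ (twist-shift a f j) ⟩
    - (neg1^ a * shift a (twist f) j)   ≡⟨ neg-distribˡ-* (neg1^ a) _ ⟩
    - neg1^ a * shift a (twist f) j     ∎

  twist-⊖ : (f g : Series) → twist (f ⊖ g) ≈ twist f ⊖ twist g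
  twist-⊖ f g j = distrib (neg1^ j) (f j) (g j)
    where
    distrib : ∀ s x y → s * (x - y) ≡ s * x - s * y
    distrib = solve-∀

module Shanks where

  open Comparisons using (suc-+∸)
  open Signs
  open Series
  open import Data.Nat as ℕ using (ℕ; zero; suc; _∸_; _≤_; z≤n; s≤s)
  open import Data.Nat.Properties
    using (+-comm; +-suc; ≤-refl; ≤-trans; ≤-<-trans; <⇒≤; m≤n⇒m≤1+n; m≤n+m; m≤m*n; m<m+n;
           m+n∸m≡n; m+[n∸m]≡n; n∸n≡0)
  import Data.Nat.Properties as ℕₚ
  import Data.Nat.Tactic.RingSolver as ℕ-Ring
  open import Data.Integer using (_+_; _*_; -_; _-_; 0ℤ)
  open import Data.Integer.Properties using (+-identityˡ; +-identityʳ; *-identityˡ; *-zeroʳ)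
  open import Data.Integer.Tactic.RingSolver using (solve-∀)
  open import Relation.Binary.PropositionalEquality
  open ≡-Reasoning

  triangle : ℕ → ℕ
  triangle zero    = 0
  triangle (suc k) = triangle k ℕ.+ suc k

  q^_ : ℕ → Series
  q^ e = shift e 𝟏

  times1-q^ : ℕ → Series → Series
  times1-q^ a f = f ⊖ shift a f

  -- eulerFrom k d = (1 - q^(k+1)) ⋯ (1 - q^(k+d)), so eulerFrom 0 n = (q;q)_n.
  eulerFrom : ℕ → ℕ → Series
  eulerFrom k zero    = 𝟏
  eulerFrom k (suc d) = times1-q^ (k ℕ.+ suc d) (eulerFrom k d)

  times1-q^-cong : (a : ℕ) {f g : Series} → f ≈ g → times1-q^ a f ≈ times1-q^ a g
  times1-q^-cong a e j = cong₂ _-_ (e j) (shift-cong a e j)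

  times1-q^-comm : (a b : ℕ) (f : Series) → times1-q^ a (times1-q^ b f) ≈ times1-q^ b (times1-q^ a f)
  times1-q^-comm a b f j = begin
    (f j - shift b f j) - shift a (f ⊖ shift b f) j       ≡⟨ cong (_-_ (f j - shift b f j)) (shift-⊖ a f (shift b f) j) ⟩
    (f j - shift b f j) - (shift a f j - shift a (shift b f) j)
      ≡⟨ exchange (f j) (shift b f j) (shift a f j) (shift a (shift b f) j) ⟩
    (f j - shift a f j) - (shift b f j - shift a (shift b f) j)
      ≡⟨ cong (λ z → (f j - shift a f j) - (shift b f j - z)) shifts-commute ⟩
    (f j - shift a f j) - (shift b f j - shift b (shift a f) j) ≡⟨ cong (_-_ (f j - shift a f j)) (shift-⊖ b f (shift a f) j) ⟨
    (f j - shift a f j) - shift b (f ⊖ shift a f) j       ∎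
    where
    exchange : ∀ x y z w → (x - y) - (z - w) ≡ (x - z) - (y - w)
    exchange = solve-∀
    shifts-commute : shift a (shift b f) j ≡ shift b (shift a f) j
    shifts-commute = trans (shift-shift a b f j) (trans (shift-≡ (+-comm a b) f j) (sym (shift-shift b a f j)))

  eulerFrom-suc : (k d : ℕ) → eulerFrom k (suc d) ≈ times1-q^ (suc k) (eulerFrom (suc k) d)
  eulerFrom-suc k zero    j = cong (_-_ (𝟏 j)) (shift-≡ (+-comm k 1) 𝟏 j)
  eulerFrom-suc k (suc d) = ≈-trans (times1-q^-cong (k ℕ.+ suc (suc d)) (eulerFrom-suc k d))
    (≈-trans (times1-q^-comm (k ℕ.+ suc (suc d)) (suc k) (eulerFrom (suc k) d))
      (times1-q^-cong (suc k) (λ j → cong (_-_ (eulerFrom (suc k) d j)) (shift-≡ (+-suc k (suc d)) (eulerFrom (suc k) d) j))))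

  -- Shanks' finite form of Euler's pentagonal theorem: the sum over k ≤ n of
  -- (-1)^k q^(nk + k(k+1)/2) (q^(k+1);q)_(n-k) starts with (q;q)_n, and its increment
  -- from n to n+1 is a pair of pentagonal monomials, by telescoping.
  shanksTerm : ℕ → ℕ → Series
  shanksTerm n k = shift (n ℕ.* k ℕ.+ triangle k) (eulerFrom k (n ∸ k))

  shanksCorrection : ℕ → ℕ → Series
  shanksCorrection m zero    = 𝟎
  shanksCorrection m (suc k) = shift (m ℕ.* suc k ℕ.+ triangle (suc k)) (eulerFrom k (m ∸ k))

  shanksTerm-shift : (k d : ℕ) → let m = k ℕ.+ d in
    shift (m ℕ.* k ℕ.+ triangle k) (shift k (eulerFrom k d)) ≈ shanksTerm m k ⊖ shanksCorrection m k
  shanksTerm-shift zero     d j = sym (+-identityʳ _)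
  shanksTerm-shift (suc k′) d j = begin
    shift e (shift k (eulerFrom k d)) j
      ≡⟨ subtract-twice (shift e (eulerFrom k d) j) _ ⟩
    shift e (eulerFrom k d) j - (shift e (eulerFrom k d) j - shift e (shift k (eulerFrom k d)) j)
      ≡⟨ cong₂ _-_ (cong (λ z → shift e (eulerFrom k z) j) (sym (m+n∸m≡n k d))) (sym correction) ⟩
    shanksTerm m k j - shanksCorrection m k j ∎
    where
    k = suc k′
    m = k ℕ.+ d
    e = m ℕ.* k ℕ.+ triangle k
    subtract-twice : ∀ x y → y ≡ x - (x - y)
    subtract-twice = solve-∀
    correction : shanksCorrection m k j ≡ shift e (eulerFrom k d) j - shift e (shift k (eulerFrom k d)) j
    correction = trans (cong (λ z → shift e (eulerFrom k′ z) j) (suc-+∸ k′ d))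
      (trans (shift-cong e (eulerFrom-suc k′ d) j) (shift-⊖ e (eulerFrom k d) (shift k (eulerFrom k d)) j))

  shanksTerm-suc-+ : (k d : ℕ) → let m = k ℕ.+ d in
    shanksTerm (suc m) k ≈ shanksTerm m k ⊖ shanksCorrection m k ⊖ shanksCorrection m (suc k)
  shanksTerm-suc-+ k d j = begin
    shanksTerm (suc (k ℕ.+ d)) k j
      ≡⟨ cong (λ z → shift e′ (eulerFrom k z) j) (suc-+∸ k d) ⟩
    shift e′ (eulerFrom k (suc d)) j
      ≡⟨ shift-⊖ e′ (eulerFrom k d) (shift (k ℕ.+ suc d) (eulerFrom k d)) j ⟩
    shift e′ (eulerFrom k d) j - shift e′ (shift (k ℕ.+ suc d) (eulerFrom k d)) j
      ≡⟨ cong₂ _-_ lower upper ⟩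
    shift e (shift k (eulerFrom k d)) j - shanksCorrection (k ℕ.+ d) (suc k) j
      ≡⟨ cong (_- shanksCorrection (k ℕ.+ d) (suc k) j) (shanksTerm-shift k d j) ⟩
    shanksTerm (k ℕ.+ d) k j - shanksCorrection (k ℕ.+ d) k j - shanksCorrection (k ℕ.+ d) (suc k) j ∎
    where
    e  = (k ℕ.+ d) ℕ.* k ℕ.+ triangle k
    e′ = suc (k ℕ.+ d) ℕ.* k ℕ.+ triangle k
    lower : shift e′ (eulerFrom k d) j ≡ shift e (shift k (eulerFrom k d)) j
    lower = trans (shift-≡ (exponent (k ℕ.+ d) k (triangle k)) (eulerFrom k d) j) (sym (shift-shift e k (eulerFrom k d) j))
      where
      exponent : ∀ m k t → suc m ℕ.* k ℕ.+ t ≡ (m ℕ.* k ℕ.+ t) ℕ.+ k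
      exponent = ℕ-Ring.solve-∀
    upper : shift e′ (shift (k ℕ.+ suc d) (eulerFrom k d)) j ≡ shanksCorrection (k ℕ.+ d) (suc k) j
    upper = trans (shift-shift e′ (k ℕ.+ suc d) (eulerFrom k d) j)
      (trans (shift-≡ (exponent k d (triangle k)) (eulerFrom k d) j)
             (cong (λ z → shift ((k ℕ.+ d) ℕ.* suc k ℕ.+ triangle (suc k)) (eulerFrom k z) j) (sym (m+n∸m≡n k d))))
      where
      exponent : ∀ k d t → suc (k ℕ.+ d) ℕ.* k ℕ.+ t ℕ.+ (k ℕ.+ suc d) ≡ (k ℕ.+ d) ℕ.* suc k ℕ.+ (t ℕ.+ suc k)
      exponent = ℕ-Ring.solve-∀

  shanksTerm-suc : {m k : ℕ} → k ≤ m →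
    shanksTerm (suc m) k ≈ shanksTerm m k ⊖ shanksCorrection m k ⊖ shanksCorrection m (suc k)
  shanksTerm-suc {m} {k} k≤m =
    subst (λ m → shanksTerm (suc m) k ≈ shanksTerm m k ⊖ shanksCorrection m k ⊖ shanksCorrection m (suc k))
          (m+[n∸m]≡n k≤m) (shanksTerm-suc-+ k (m ∸ k))

  seriesSum : ℕ → (ℕ → Series) → Series
  seriesSum zero    F = 𝟎
  seriesSum (suc j) F = seriesSum j F ⊕ F j

  seriesSum-split : (j : ℕ) (F G H : ℕ → Series) → (∀ k → F k ≈ G k ⊕ H k) →
                    seriesSum j F ≈ seriesSum j G ⊕ seriesSum j H
  seriesSum-split zero    F G H e i = refl
  seriesSum-split (suc j) F G H e i rewrite seriesSum-split j F G H e i | e j i =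
    interchange (seriesSum j G i) (seriesSum j H i) (G j i) (H j i)
    where
    interchange : ∀ a b c d → (a + b) + (c + d) ≡ (a + c) + (b + d)
    interchange = solve-∀

  shanksIncrement-telescopes : (m j : ℕ) → j ≤ suc m →
    seriesSum j (λ k → neg1^ k · (shanksTerm (suc m) k ⊖ shanksTerm m k)) ≈ neg1^ j · shanksCorrection m j
  shanksIncrement-telescopes m zero    _         i = refl
  shanksIncrement-telescopes m (suc j) (s≤s j≤m) i
    rewrite shanksIncrement-telescopes m j (m≤n⇒m≤1+n j≤m) i | shanksTerm-suc j≤m i =
    telescope (neg1^ j) (shanksCorrection m j i) (shanksCorrection m (suc j) i) (shanksTerm m j i)
    where
    telescope : ∀ s c c′ a → s * c + s * ((a - c - c′) - a) ≡ (- s) * c′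
    telescope = solve-∀

  shanksSum : ℕ → Series
  shanksSum n = seriesSum (suc n) (λ k → neg1^ k · shanksTerm n k)

  pent⁻ pent⁺ : ℕ → ℕ
  pent⁻ m = m ℕ.* suc m ℕ.+ triangle (suc m)
  pent⁺ m = suc m ℕ.* suc m ℕ.+ triangle (suc m)

  shanksSum-suc : (m : ℕ) → shanksSum (suc m) ≈ shanksSum m ⊕ neg1^ (suc m) · (q^ pent⁻ m ⊕ q^ pent⁺ m)
  shanksSum-suc m i = begin
    seriesSum (suc m) (λ k → neg1^ k · shanksTerm (suc m) k) i + neg1^ (suc m) * shanksTerm (suc m) (suc m) i
      ≡⟨ cong (_+ neg1^ (suc m) * shanksTerm (suc m) (suc m) i) (seriesSum-split (suc m) _ _ _ split i) ⟩
    (shanksSum m i + seriesSum (suc m) (λ k → neg1^ k · (shanksTerm (suc m) k ⊖ shanksTerm m k)) i)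
      + neg1^ (suc m) * shanksTerm (suc m) (suc m) i
      ≡⟨ cong (λ z → (shanksSum m i + z) + neg1^ (suc m) * shanksTerm (suc m) (suc m) i)
              (shanksIncrement-telescopes m (suc m) ≤-refl i) ⟩
    (shanksSum m i + neg1^ (suc m) * shanksCorrection m (suc m) i) + neg1^ (suc m) * shanksTerm (suc m) (suc m) i
      ≡⟨ factor (shanksSum m i) (neg1^ (suc m)) _ _ ⟩
    shanksSum m i + neg1^ (suc m) * (shanksCorrection m (suc m) i + shanksTerm (suc m) (suc m) i)
      ≡⟨ cong (λ z → shanksSum m i + neg1^ (suc m) * z) (cong₂ _+_ (empty m (pent⁻ m)) (empty (suc m) (pent⁺ m))) ⟩
    shanksSum m i + neg1^ (suc m) * (q^ pent⁻ m ⊕ q^ pent⁺ m) i ∎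
    where
    split : ∀ k → neg1^ k · shanksTerm (suc m) k ≈ neg1^ k · shanksTerm m k ⊕ neg1^ k · (shanksTerm (suc m) k ⊖ shanksTerm m k)
    split k i = difference (neg1^ k) (shanksTerm (suc m) k i) (shanksTerm m k i)
      where
      difference : ∀ s a b → s * a ≡ s * b + s * (a - b)
      difference = solve-∀
    factor : ∀ y s c a → (y + s * c) + s * a ≡ y + s * (c + a)
    factor = solve-∀
    empty : ∀ k e → shift e (eulerFrom k (k ∸ k)) i ≡ (q^ e) i
    empty k e = cong (λ z → shift e (eulerFrom k z) i) (n∸n≡0 k)

  pentagonalSeries : ℕ → Series
  pentagonalSeries zero    = 𝟏
  pentagonalSeries (suc m) = pentagonalSeries m ⊕ neg1^ (suc m) · (q^ pent⁻ m ⊕ q^ pent⁺ m)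

  shanksSum≈pentagonalSeries : (m : ℕ) → shanksSum m ≈ pentagonalSeries m
  shanksSum≈pentagonalSeries zero    zero    = refl
  shanksSum≈pentagonalSeries zero    (suc i) = refl
  shanksSum≈pentagonalSeries (suc m) i =
    trans (shanksSum-suc m i) (cong (_+ (neg1^ (suc m) · (q^ pent⁻ m ⊕ q^ pent⁺ m)) i) (shanksSum≈pentagonalSeries m i))

  shanksTerm-high : (n k : ℕ) {j : ℕ} → j ≤ n → shanksTerm n (suc k) j ≡ 0ℤ
  shanksTerm-high n k {j} j≤n = shift-below (n ℕ.* suc k ℕ.+ triangle (suc k)) _
    (≤-<-trans (≤-trans j≤n (m≤m*n n (suc k))) (m<m+n _ (≤-trans (s≤s z≤n) (m≤n+m (suc k) (triangle k)))))

  shanksSum-low : {N j : ℕ} → j ≤ N → shanksSum N j ≡ eulerFrom 0 N j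
  shanksSum-low {N} {j} j≤N = go N ≤-refl
    where
    go : ∀ r → r ≤ N → seriesSum (suc r) (λ k → neg1^ k · shanksTerm N k) j ≡ eulerFrom 0 N j
    go zero    _   = trans (+-identityˡ _) (trans (*-identityˡ _)
      (shift-≡ (trans (ℕₚ.+-identityʳ (N ℕ.* 0)) (ℕₚ.*-zeroʳ N)) (eulerFrom 0 N) j))
    go (suc r) r<N = begin
      seriesSum (suc r) _ j + neg1^ (suc r) * shanksTerm N (suc r) j
        ≡⟨ cong₂ (λ u v → u + neg1^ (suc r) * v) (go r (<⇒≤ r<N)) (shanksTerm-high N r j≤N) ⟩
      eulerFrom 0 N j + neg1^ (suc r) * 0ℤ
        ≡⟨ cong (eulerFrom 0 N j +_) (*-zeroʳ (neg1^ (suc r))) ⟩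
      eulerFrom 0 N j + 0ℤ
        ≡⟨ +-identityʳ _ ⟩
      eulerFrom 0 N j ∎

  euler-pentagonal : {N j : ℕ} → j ≤ N → eulerFrom 0 N j ≡ pentagonalSeries N j
  euler-pentagonal {N} {j} j≤N = trans (sym (shanksSum-low j≤N)) (shanksSum≈pentagonalSeries N j)

module ProductFormula where

  open Partitions using (pAtMost; pAtMost-suc)
  open OddOverpartitions using (ovAtMost; ovFollowingAtMost; ovAtMost-suc; ovFollowingAtMost-eq)
  open Signs
  open Series
  open Shanks using (eulerFrom)
  open import Data.Nat as ℕ using (ℕ; zero; suc; _∸_; _≤ᵇ_)
  import Data.Nat.Properties as ℕₚ
  open import Data.Integer using (+_; _+_; _*_; _-_; 0ℤ; 1ℤ; -1ℤ)
  open import Data.Integer.Properties using (pos-+; pos-*)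
  open import Data.Integer.Tactic.RingSolver using (solve-∀)
  open import Data.Bool using (Bool; true; false; _∧_; if_then_else_)
  open import Data.Bool.Properties using (∧-identityʳ; ∧-zeroʳ)
  open import Relation.Binary.PropositionalEquality
  open ≡-Reasoning

  pSeries ovSeries ovFollowingSeries : ℕ → Series
  pSeries           m s = + pAtMost m s
  ovSeries          m s = + ovAtMost m s
  ovFollowingSeries m s = + ovFollowingAtMost m s

  -- ∏_{i ≤ m} (1 - (-q)^i) = ∏_{odd i ≤ m} (1 + q^i) ∏_{even i ≤ m} (1 - q^i)
  twistedEuler : ℕ → Series
  twistedEuler m = twist (eulerFrom 0 m)

  +-if : (g : Bool) (x : ℕ) → + (if g then x else 0) ≡ (if g then + x else 0ℤ)
  +-if true  x = refl
  +-if false x = refl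

  if-∧ : (g : Bool) {c : Bool} (x : ℕ) → c ≡ true → (if g ∧ c then x else 0) ≡ (if g then x else 0)
  if-∧ g x refl = cong (λ b → if b then x else 0) (∧-identityʳ g)

  pos-step : (a s x y : ℕ) (F : Series) → F (s ∸ a) ≡ + y →
           + (x ℕ.+ (if a ≤ᵇ s then y else 0)) ≡ + x + shift a F s
  pos-step a s x y F F≡y = begin
    + (x ℕ.+ (if a ≤ᵇ s then y else 0))       ≡⟨ pos-+ x _ ⟩
    + x + + (if a ≤ᵇ s then y else 0)         ≡⟨ cong (_+_ (+ x)) (+-if (a ≤ᵇ s) y) ⟩
    + x + (if a ≤ᵇ s then + y else 0ℤ)        ≡⟨ cong (λ z → + x + (if a ≤ᵇ s then z else 0ℤ)) F≡y ⟨
    + x + (if a ≤ᵇ s then F (s ∸ a) else 0ℤ)  ≡⟨ cong (_+_ (+ x)) (shift-if a F s) ⟨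
    + x + shift a F s                         ∎

  pSeries-suc : (m : ℕ) → pSeries (suc m) ≈ pSeries m ⊕ shift (suc m) (pSeries (suc m))
  pSeries-suc m s = trans (cong +_ (pAtMost-suc m s)) (pos-step (suc m) s _ _ (pSeries (suc m)) refl)

  module _ (m : ℕ) (odd : isOdd (suc m) ≡ true) where

    ovFollowingSeries-eq : ovFollowingSeries m ≈ ovSeries m ⊕ shift (suc m) (ovFollowingSeries m)
    ovFollowingSeries-eq s = trans (cong +_ (trans (ovFollowingAtMost-eq m s) (cong (ovAtMost m s ℕ.+_) (if-∧ (suc m ≤ᵇ s) _ odd))))
                                   (pos-step (suc m) s _ (ovFollowingAtMost m (s ∸ suc m)) (ovFollowingSeries m) refl)

    ovSeries-suc-odd : ovSeries (suc m) ≈ ovSeries m ⊕ shift (suc m) (+ 2 · ovFollowingSeries m)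
    ovSeries-suc-odd s = trans (cong +_ (trans (ovAtMost-suc m s) (cong (ovAtMost m s ℕ.+_) (if-∧ (suc m ≤ᵇ s) _ odd))))
                               (pos-step (suc m) s _ (2 ℕ.* ovFollowingAtMost m (s ∸ suc m)) (+ 2 · ovFollowingSeries m) (sym (pos-* 2 (ovFollowingAtMost m (s ∸ suc m)))))

  ovSeries-suc-even : (m : ℕ) → isOdd (suc m) ≡ false → ovSeries (suc m) ≈ ovSeries m
  ovSeries-suc-even m even s = cong +_ (trans (ovAtMost-suc m s) (trans (cong (ovAtMost m s ℕ.+_) no-part) (ℕₚ.+-identityʳ _)))
    where
    no-part : (if (suc m ≤ᵇ s) ∧ isOdd (suc m) then 2 ℕ.* ovFollowingAtMost m (s ∸ suc m) else 0) ≡ 0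
    no-part rewrite even | ∧-zeroʳ (suc m ≤ᵇ s) = refl

  twistedEuler-suc : (m : ℕ) → twistedEuler (suc m) ≈ twistedEuler m ⊖ neg1^ (suc m) · shift (suc m) (twistedEuler m)
  twistedEuler-suc m j = trans (twist-⊖ (eulerFrom 0 m) (shift (suc m) (eulerFrom 0 m)) j)
                               (cong (_-_ (twistedEuler m j)) (twist-shift (suc m) (eulerFrom 0 m) j))

  -- With V = ovSeries m, the series X = twistedEuler m ∗ pSeries (m+1) is V / (1 - q^(m+1)), the
  -- unique solution of X = V + q^(m+1) X; the new factor of twistedEuler turns it into
  -- V (1 ± q^(m+1)) / (1 - q^(m+1)), which is ovSeries (m+1) for m+1 odd (+) and even (-).
  module ProductStep (m : ℕ) (ih : ovSeries m ≈ twistedEuler m ∗ pSeries m) where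

    X : Series
    X = twistedEuler m ∗ pSeries (suc m)

    X-eq : ∀ s → X s ≡ ovSeries m s + shift (suc m) X s
    X-eq s = begin
      X s
        ≡⟨ ∗-congʳ (twistedEuler m) (pSeries-suc m) s ⟩
      (twistedEuler m ∗ (pSeries m ⊕ shift (suc m) (pSeries (suc m)))) s
        ≡⟨ ∗-distribˡ-⊕ (twistedEuler m) (pSeries m) _ s ⟩
      (twistedEuler m ∗ pSeries m) s + (twistedEuler m ∗ shift (suc m) (pSeries (suc m))) s
        ≡⟨ cong₂ _+_ (sym (ih s)) (∗-shift (suc m) (twistedEuler m) (pSeries (suc m)) s) ⟩
      ovSeries m s + shift (suc m) X s ∎

    product-suc : ∀ s → (twistedEuler (suc m) ∗ pSeries (suc m)) s ≡ X s - neg1^ (suc m) * shift (suc m) X s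
    product-suc s = begin
      (twistedEuler (suc m) ∗ pSeries (suc m)) s
        ≡⟨ ∗-congˡ (pSeries (suc m)) (twistedEuler-suc m) s ⟩
      ((twistedEuler m ⊖ neg1^ (suc m) · shift (suc m) (twistedEuler m)) ∗ pSeries (suc m)) s
        ≡⟨ ∗-distribʳ-⊖ (twistedEuler m) _ (pSeries (suc m)) s ⟩
      X s - (neg1^ (suc m) · shift (suc m) (twistedEuler m) ∗ pSeries (suc m)) s
        ≡⟨ cong (_-_ (X s)) (·-∗ (neg1^ (suc m)) (shift (suc m) (twistedEuler m)) (pSeries (suc m)) s) ⟩
      X s - neg1^ (suc m) * (shift (suc m) (twistedEuler m) ∗ pSeries (suc m)) s
        ≡⟨ cong (λ z → X s - neg1^ (suc m) * z) (shift-∗ (suc m) (twistedEuler m) (pSeries (suc m)) s) ⟩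
      X s - neg1^ (suc m) * shift (suc m) X s ∎

  neg1^-parity : {a : ℕ} {b : Bool} → isOdd a ≡ b → neg1^ a ≡ (if b then -1ℤ else 1ℤ)
  neg1^-parity {a} refl = neg1^-isOdd a

  ovSeries≈twistedEuler∗pSeries : (m : ℕ) → ovSeries m ≈ twistedEuler m ∗ pSeries m
  ovSeries≈twistedEuler∗pSeries zero s = trans (cong +_ (same s)) (sym (trans (∗-congˡ (pSeries 0) twist-𝟏 s) (∗-identityˡ (pSeries 0) s)))
    where
    same : ∀ s → ovAtMost 0 s ≡ pAtMost 0 s
    same zero    = refl
    same (suc s) = refl
  ovSeries≈twistedEuler∗pSeries (suc m) s with isOdd (suc m) in parity
  ... | true = begin
    ovSeries (suc m) s                               ≡⟨ ovSeries-suc-odd m parity s ⟩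
    ovSeries m s + shift (suc m) (+ 2 · W) s         ≡⟨ cong (_+_ (ovSeries m s)) (shift-cong (suc m) (λ j → cong (+ 2 *_) (W≈X j)) s) ⟩
    ovSeries m s + shift (suc m) (+ 2 · X) s         ≡⟨ cong (_+_ (ovSeries m s)) (shift-· (suc m) (+ 2) X s) ⟩
    ovSeries m s + + 2 * shift (suc m) X s           ≡⟨ regroup (ovSeries m s) (shift (suc m) X s) ⟩
    (ovSeries m s + shift (suc m) X s) - -1ℤ * shift (suc m) X s
                                                     ≡⟨ cong₂ (λ u v → u - v * shift (suc m) X s) (sym (X-eq s)) (sym (neg1^-parity {suc m} parity)) ⟩
    X s - neg1^ (suc m) * shift (suc m) X s          ≡⟨ product-suc s ⟨
    (twistedEuler (suc m) ∗ pSeries (suc m)) s       ∎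
    where
    open ProductStep m (ovSeries≈twistedEuler∗pSeries m)
    W = ovFollowingSeries m
    W≈X : W ≈ X
    W≈X = shift-fixpoint-unique m (ovSeries m) W X (ovFollowingSeries-eq m parity) X-eq
    regroup : ∀ v y → v + + 2 * y ≡ (v + y) - -1ℤ * y
    regroup = solve-∀
  ... | false = begin
    ovSeries (suc m) s                               ≡⟨ ovSeries-suc-even m parity s ⟩
    ovSeries m s                                     ≡⟨ regroup (ovSeries m s) (shift (suc m) X s) ⟩
    (ovSeries m s + shift (suc m) X s) - 1ℤ * shift (suc m) X s
                                                     ≡⟨ cong₂ (λ u v → u - v * shift (suc m) X s) (sym (X-eq s)) (sym (neg1^-parity {suc m} parity)) ⟩
    X s - neg1^ (suc m) * shift (suc m) X s          ≡⟨ product-suc s ⟨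
    (twistedEuler (suc m) ∗ pSeries (suc m)) s       ∎
    where
    open ProductStep m (ovSeries≈twistedEuler∗pSeries m)
    regroup : ∀ v y → v ≡ (v + y) - 1ℤ * y
    regroup = solve-∀

module Pentagonal where

  open Signs
  open Shanks using (triangle; pent⁻; pent⁺)
  open import Data.Nat as ℕ using (ℕ; zero; suc; z≤n; s≤s)
  open import Data.Nat.DivMod using (_/_; m*n/n≡m; m/n≡1+[m∸n]/n)
  import Data.Nat.Tactic.RingSolver as ℕ-Ring
  open import Data.Integer using (+_; -[1+_]; _+_; _*_; -_; ∣_∣; 1ℤ; -1ℤ)
  open import Data.Integer.DivMod using (_/ℕ_)
  open import Data.Integer.Properties using (pos-+; pos-*; ∣-i∣≡∣i∣)
  open import Data.Integer.Tactic.RingSolver using (solve-∀)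
  open import Data.Bool using (if_then_else_)
  open import Relation.Binary.PropositionalEquality
  open ≡-Reasoning

  triangle-*2 : (k : ℕ) → triangle k ℕ.* 2 ≡ k ℕ.* suc k
  triangle-*2 zero    = refl
  triangle-*2 (suc k) = begin
    (triangle k ℕ.+ suc k) ℕ.* 2        ≡⟨ distrib (triangle k) k ⟩
    triangle k ℕ.* 2 ℕ.+ suc k ℕ.* 2    ≡⟨ cong (ℕ._+ suc k ℕ.* 2) (triangle-*2 k) ⟩
    k ℕ.* suc k ℕ.+ suc k ℕ.* 2         ≡⟨ collect k ⟩
    suc k ℕ.* suc (suc k)               ∎
    where
    distrib : ∀ t k → (t ℕ.+ suc k) ℕ.* 2 ≡ t ℕ.* 2 ℕ.+ suc k ℕ.* 2
    distrib = ℕ-Ring.solve-∀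
    collect : ∀ k → k ℕ.* suc k ℕ.+ suc k ℕ.* 2 ≡ suc k ℕ.* suc (suc k)
    collect = ℕ-Ring.solve-∀

  pent⁺-*2 : (m : ℕ) → suc m ℕ.* (3 ℕ.* suc m ℕ.+ 1) ≡ pent⁺ m ℕ.* 2
  pent⁺-*2 m = begin
    suc m ℕ.* (3 ℕ.* suc m ℕ.+ 1)                          ≡⟨ expand m ⟩
    suc m ℕ.* suc m ℕ.* 2 ℕ.+ suc m ℕ.* suc (suc m)        ≡⟨ cong (suc m ℕ.* suc m ℕ.* 2 ℕ.+_) (triangle-*2 (suc m)) ⟨
    suc m ℕ.* suc m ℕ.* 2 ℕ.+ triangle (suc m) ℕ.* 2       ≡⟨ collect (suc m ℕ.* suc m) (triangle (suc m)) ⟩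
    pent⁺ m ℕ.* 2                                          ∎
    where
    expand : ∀ m → suc m ℕ.* (3 ℕ.* suc m ℕ.+ 1) ≡ suc m ℕ.* suc m ℕ.* 2 ℕ.+ suc m ℕ.* suc (suc m)
    expand = ℕ-Ring.solve-∀
    collect : ∀ a t → a ℕ.* 2 ℕ.+ t ℕ.* 2 ≡ (a ℕ.+ t) ℕ.* 2
    collect = ℕ-Ring.solve-∀

  pent⁻-*2 : (m : ℕ) → suc m ℕ.* (3 ℕ.* m ℕ.+ 2) ≡ pent⁻ m ℕ.* 2
  pent⁻-*2 m = begin
    suc m ℕ.* (3 ℕ.* m ℕ.+ 2)                              ≡⟨ expand m ⟩
    m ℕ.* suc m ℕ.* 2 ℕ.+ suc m ℕ.* suc (suc m)            ≡⟨ cong (m ℕ.* suc m ℕ.* 2 ℕ.+_) (triangle-*2 (suc m)) ⟨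
    m ℕ.* suc m ℕ.* 2 ℕ.+ triangle (suc m) ℕ.* 2           ≡⟨ collect (m ℕ.* suc m) (triangle (suc m)) ⟩
    pent⁻ m ℕ.* 2                                          ∎
    where
    expand : ∀ m → suc m ℕ.* (3 ℕ.* m ℕ.+ 2) ≡ m ℕ.* suc m ℕ.* 2 ℕ.+ suc m ℕ.* suc (suc m)
    expand = ℕ-Ring.solve-∀
    collect : ∀ a t → a ℕ.* 2 ℕ.+ t ℕ.* 2 ≡ (a ℕ.+ t) ℕ.* 2
    collect = ℕ-Ring.solve-∀

  pent-pos : (m : ℕ) → pent (+ suc m) ≡ + pent⁺ m
  pent-pos m = begin
    (+ suc m * (+ 3 * + suc m + + 1)) /ℕ 2     ≡⟨ cong (_/ℕ 2) (cong (λ z → + suc m * (z + + 1)) (pos-* 3 (suc m))) ⟨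
    (+ suc m * (+ (3 ℕ.* suc m) + + 1)) /ℕ 2   ≡⟨ cong (λ z → (+ suc m * z) /ℕ 2) (pos-+ (3 ℕ.* suc m) 1) ⟨
    (+ suc m * + (3 ℕ.* suc m ℕ.+ 1)) /ℕ 2     ≡⟨ cong (_/ℕ 2) (pos-* (suc m) (3 ℕ.* suc m ℕ.+ 1)) ⟨
    + (suc m ℕ.* (3 ℕ.* suc m ℕ.+ 1)) /ℕ 2     ≡⟨ cong (λ z → + z /ℕ 2) (pent⁺-*2 m) ⟩
    + (pent⁺ m ℕ.* 2 / 2)                      ≡⟨ cong +_ (m*n/n≡m (pent⁺ m) 2) ⟩
    + pent⁺ m                                  ∎

  pent-neg : (m : ℕ) → pent -[1+ m ] ≡ + pent⁻ m
  pent-neg m = begin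
    (-[1+ m ] * (+ 3 * -[1+ m ] + + 1)) /ℕ 2   ≡⟨ cong (λ z → (- z * (+ 3 * - z + + 1)) /ℕ 2) (pos-+ 1 m) ⟩
    (- (1ℤ + + m) * (+ 3 * - (1ℤ + + m) + 1ℤ)) /ℕ 2
                                               ≡⟨ cong (_/ℕ 2) (negate (+ m)) ⟩
    ((1ℤ + + m) * (+ 3 * + m + + 2)) /ℕ 2      ≡⟨ cong₂ (λ u v → (u * (v + + 2)) /ℕ 2) (pos-+ 1 m) (pos-* 3 m) ⟨
    (+ suc m * (+ (3 ℕ.* m) + + 2)) /ℕ 2       ≡⟨ cong (λ z → (+ suc m * z) /ℕ 2) (pos-+ (3 ℕ.* m) 2) ⟨
    (+ suc m * + (3 ℕ.* m ℕ.+ 2)) /ℕ 2         ≡⟨ cong (_/ℕ 2) (pos-* (suc m) (3 ℕ.* m ℕ.+ 2)) ⟨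
    + (suc m ℕ.* (3 ℕ.* m ℕ.+ 2)) /ℕ 2         ≡⟨ cong (λ z → + z /ℕ 2) (pent⁻-*2 m) ⟩
    + (pent⁻ m ℕ.* 2 / 2)                      ≡⟨ cong +_ (m*n/n≡m (pent⁻ m) 2) ⟩
    + pent⁻ m                                  ∎
    where
    negate : ∀ y → - (1ℤ + y) * (+ 3 * - (1ℤ + y) + 1ℤ) ≡ (1ℤ + y) * (+ 3 * y + + 2)
    negate = solve-∀

  neg1^-period2 : (h e d : ℕ → ℕ) →
    (∀ m → h (suc (suc m)) ≡ suc (h m)) → (∀ m → e (suc (suc m)) ≡ e m ℕ.+ suc (2 ℕ.* d m)) →
    neg1^ (h 0) ≡ neg1^ 1 * neg1^ (e 0) → neg1^ (h 1) ≡ neg1^ 2 * neg1^ (e 1) →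
    ∀ m → neg1^ (h m) ≡ neg1^ (suc m) * neg1^ (e m)
  neg1^-period2 h e d h-step e-step base₀ base₁ zero          = base₀
  neg1^-period2 h e d h-step e-step base₀ base₁ (suc zero)    = base₁
  neg1^-period2 h e d h-step e-step base₀ base₁ (suc (suc m)) = begin
    neg1^ (h (suc (suc m)))                        ≡⟨ cong neg1^ (h-step m) ⟩
    - neg1^ (h m)                                  ≡⟨ cong -_ (neg1^-period2 h e d h-step e-step base₀ base₁ m) ⟩
    - (neg1^ (suc m) * neg1^ (e m))                ≡⟨ flip (neg1^ (suc m)) (neg1^ (e m)) ⟩
    - - neg1^ (suc m) * - neg1^ (e m)              ≡⟨ cong (- - neg1^ (suc m) *_) (trans (cong neg1^ (e-step m)) (neg1^-+odd (e m) (d m))) ⟨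
    neg1^ (suc (suc (suc m))) * neg1^ (e (suc (suc m))) ∎
    where
    flip : ∀ a b → - (a * b) ≡ - - a * - b
    flip = solve-∀

  ⌊/2⌋-2+ : (x : ℕ) → suc (suc x) / 2 ≡ suc (x / 2)
  ⌊/2⌋-2+ x = m/n≡1+[m∸n]/n {suc (suc x)} {2} (s≤s (s≤s z≤n))

  negOnePow-ceilHalf-pos : (m : ℕ) → negOnePow (ceilHalf (+ suc m)) ≡ neg1^ (suc m) * neg1^ (pent⁺ m)
  negOnePow-ceilHalf-pos m = trans (sym (neg1^-isOdd (suc (suc m) / 2)))
    (neg1^-period2 (λ m → suc (suc m) / 2) pent⁺ (λ m → 3 ℕ.* m ℕ.+ 6) (λ m → ⌊/2⌋-2+ (suc (suc m))) pent⁺-2+ refl refl m)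
    where
    pent⁺-2+ : ∀ m → pent⁺ (suc (suc m)) ≡ pent⁺ m ℕ.+ suc (2 ℕ.* (3 ℕ.* m ℕ.+ 6))
    pent⁺-2+ m = expand m (triangle (suc m))
      where
      expand : ∀ m t → suc (suc (suc m)) ℕ.* suc (suc (suc m)) ℕ.+ ((t ℕ.+ suc (suc m)) ℕ.+ suc (suc (suc m)))
                       ≡ (suc m ℕ.* suc m ℕ.+ t) ℕ.+ suc (2 ℕ.* (3 ℕ.* m ℕ.+ 6))
      expand = ℕ-Ring.solve-∀

  negOnePow-ceilHalf-neg : (m : ℕ) → negOnePow (ceilHalf -[1+ m ]) ≡ neg1^ (suc m) * neg1^ (pent⁻ m)
  negOnePow-ceilHalf-neg m = begin
    (if isOdd ∣ - + (suc m / 2) ∣ then -1ℤ else 1ℤ) ≡⟨ cong (λ z → if isOdd z then -1ℤ else 1ℤ) (∣-i∣≡∣i∣ (+ (suc m / 2))) ⟩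
    (if isOdd (suc m / 2) then -1ℤ else 1ℤ)       ≡⟨ neg1^-isOdd (suc m / 2) ⟨
    neg1^ (suc m / 2)                             ≡⟨ neg1^-period2 (λ m → suc m / 2) pent⁻ (λ m → 3 ℕ.* m ℕ.+ 5)
                                                       (λ m → ⌊/2⌋-2+ (suc m)) pent⁻-2+ refl refl m ⟩
    neg1^ (suc m) * neg1^ (pent⁻ m)               ∎
    where
    pent⁻-2+ : ∀ m → pent⁻ (suc (suc m)) ≡ pent⁻ m ℕ.+ suc (2 ℕ.* (3 ℕ.* m ℕ.+ 5))
    pent⁻-2+ m = expand m (triangle (suc m))
      where
      expand : ∀ m t → suc (suc m) ℕ.* suc (suc (suc m)) ℕ.+ ((t ℕ.+ suc (suc m)) ℕ.+ suc (suc (suc m)))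
                       ≡ (m ℕ.* suc m ℕ.+ t) ℕ.+ suc (2 ℕ.* (3 ℕ.* m ℕ.+ 5))
      expand = ℕ-Ring.solve-∀

module PentagonalCoefficients where

  open Comparisons using (≤ᵇ-true⁻¹; ≤ᵇ-false⁻¹)
  open Signs
  open Series
  open Shanks using (q^_; pent⁻; pent⁺; pentagonalSeries)
  open Pentagonal using (pent-pos; pent-neg; negOnePow-ceilHalf-pos; negOnePow-ceilHalf-neg)
  open import Data.Nat as ℕ using (ℕ; zero; suc; _≤_; _<_; _≤ᵇ_)
  open import Data.Nat.Properties using (≤-refl; m∸n≤m; m<n⇒0<n∸m)
  open import Data.Integer using (+_; -[1+_]; _+_; _*_; -_; _-_; 0ℤ)
  open import Data.Integer.Properties using (+-identityʳ; *-identityˡ; m-n≡m⊖n; ⊖-≥; ⊖-<)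
  open import Data.Integer.Tactic.RingSolver using (solve-∀)
  open import Data.Bool using (true; false; if_then_else_)
  open import Relation.Binary.PropositionalEquality
  open ≡-Reasoning

  twist-q^ : (e : ℕ) → twist (q^ e) ≈ neg1^ e · q^ e
  twist-q^ e j = trans (twist-shift e 𝟏 j) (cong (neg1^ e *_) (shift-cong e twist-𝟏 j))

  q^-∗ : (e : ℕ) (f : Series) → q^ e ∗ f ≈ shift e f
  q^-∗ e f n = trans (shift-∗ e 𝟏 f n) (shift-cong e (∗-identityˡ f) n)

  twist-pentagonalSeries-suc : (m : ℕ) → twist (pentagonalSeries (suc m))
    ≈ twist (pentagonalSeries m) ⊕ neg1^ (suc m) · (neg1^ (pent⁻ m) · q^ pent⁻ m ⊕ neg1^ (pent⁺ m) · q^ pent⁺ m)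
  twist-pentagonalSeries-suc m j =
    trans (distrib (neg1^ j) (pentagonalSeries m j) (neg1^ (suc m)) ((q^ pent⁻ m) j) ((q^ pent⁺ m) j))
          (cong (λ z → twist (pentagonalSeries m) j + neg1^ (suc m) * z) (cong₂ _+_ (twist-q^ (pent⁻ m) j) (twist-q^ (pent⁺ m) j)))
    where
    distrib : ∀ s t c a b → s * (t + c * (a + b)) ≡ s * t + c * (s * a + s * b)
    distrib = solve-∀

  module _ (n : ℕ) (P : Series) (P≡p : ∀ {j} → j ≤ n → P j ≡ + p j) where

    pℤ-shift : (e : ℕ) → + pℤ (+ n - + e) ≡ shift e P n
    pℤ-shift e rewrite shift-if e P n | m-n≡m⊖n n e with e ≤ᵇ n in e≤n
    ... | true  = trans (cong (λ z → + pℤ z) (⊖-≥ {n} {e} (≤ᵇ-true⁻¹ {e} {n} e≤n))) (sym (P≡p (m∸n≤m n e)))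
    ... | false = trans (cong (λ z → + pℤ z) (⊖-< {n} {e} n<e)) (cong +_ (pℤ-negative (m<n⇒0<n∸m n<e)))
      where
      n<e = ≤ᵇ-false⁻¹ {e} {n} e≤n
      pℤ-negative : ∀ {y} → 0 < y → pℤ (- + y) ≡ 0
      pℤ-negative {suc y} _ = refl

    term-pos : (m : ℕ) → term n (+ suc m) ≡ (neg1^ (suc m) * neg1^ (pent⁺ m)) * shift (pent⁺ m) P n
    term-pos m = cong₂ _*_ (negOnePow-ceilHalf-pos m) (trans (cong (λ z → + pℤ (+ n - z)) (pent-pos m)) (pℤ-shift (pent⁺ m)))

    term-neg : (m : ℕ) → term n -[1+ m ] ≡ (neg1^ (suc m) * neg1^ (pent⁻ m)) * shift (pent⁻ m) P n
    term-neg m = cong₂ _*_ (negOnePow-ceilHalf-neg m) (trans (cong (λ z → + pℤ (+ n - z)) (pent-neg m)) (pℤ-shift (pent⁻ m)))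

    twist-pentagonalSeries-∗ : (M : ℕ) → (twist (pentagonalSeries M) ∗ P) n ≡ symSum M (term n)
    twist-pentagonalSeries-∗ zero = begin
      (twist 𝟏 ∗ P) n      ≡⟨ trans (∗-congˡ P twist-𝟏 n) (∗-identityˡ P n) ⟩
      P n                  ≡⟨ P≡p ≤-refl ⟩
      + p n                ≡⟨ cong (λ z → + pℤ z) (+-identityʳ (+ n)) ⟨
      + pℤ (+ n - 0ℤ)      ≡⟨ *-identityˡ _ ⟨
      term n (+ 0)         ∎
    twist-pentagonalSeries-∗ (suc M) = begin
      (twist (pentagonalSeries (suc M)) ∗ P) n
        ≡⟨ ∗-congˡ P (twist-pentagonalSeries-suc M) n ⟩
      ((twist (pentagonalSeries M) ⊕ s · (a · q^ pent⁻ M ⊕ b · q^ pent⁺ M)) ∗ P) n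
        ≡⟨ ∗-distribʳ-⊕ (twist (pentagonalSeries M)) _ P n ⟩
      (twist (pentagonalSeries M) ∗ P) n + (s · (a · q^ pent⁻ M ⊕ b · q^ pent⁺ M) ∗ P) n
        ≡⟨ cong₂ _+_ (twist-pentagonalSeries-∗ M) (trans (·-∗ s _ P n) (cong (s *_) (∗-distribʳ-⊕ _ _ P n))) ⟩
      symSum M (term n) + s * ((a · q^ pent⁻ M ∗ P) n + (b · q^ pent⁺ M ∗ P) n)
        ≡⟨ cong (λ z → symSum M (term n) + s * z) (cong₂ _+_ (·q^-∗ a (pent⁻ M)) (·q^-∗ b (pent⁺ M))) ⟩
      symSum M (term n) + s * (a * shift (pent⁻ M) P n + b * shift (pent⁺ M) P n)
        ≡⟨ regroup (symSum M (term n)) s a (shift (pent⁻ M) P n) b (shift (pent⁺ M) P n) ⟩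
      symSum M (term n) + (s * b) * shift (pent⁺ M) P n + (s * a) * shift (pent⁻ M) P n
        ≡⟨ cong₂ (λ u v → symSum M (term n) + u + v) (term-pos M) (term-neg M) ⟨
      symSum (suc M) (term n) ∎
      where
      s = neg1^ (suc M)
      a = neg1^ (pent⁻ M)
      b = neg1^ (pent⁺ M)
      ·q^-∗ : ∀ c e → (c · q^ e ∗ P) n ≡ c * shift e P n
      ·q^-∗ c e = trans (·-∗ c (q^ e) P n) (cong (c *_) (q^-∗ e P n))
      regroup : ∀ x s a y b z → x + s * (a * y + b * z) ≡ x + (s * b) * z + (s * a) * y
      regroup = solve-∀

open import Data.Nat.Properties using (≤-trans)
open import Data.Integer using (+_; _*_)
open import Relation.Binary.PropositionalEquality using (cong; sym; module ≡-Reasoning)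
open ≡-Reasoning
open Partitions using (p≡pAtMost)
open OddOverpartitions using (pbarO≡ovAtMost)
open Signs using (neg1^)
open Series using (_∗_; ∗-local; twist)
open Shanks using (pentagonalSeries; euler-pentagonal)
open ProductFormula using (pSeries; ovSeries; twistedEuler; ovSeries≈twistedEuler∗pSeries)
open PentagonalCoefficients using (twist-pentagonalSeries-∗)

theorem3p3 : (n N : ℕ) → n ≤ N → + pbarO n ≡ symSum N (term n)
theorem3p3 n N n≤N = begin
  + pbarO n                                   ≡⟨ cong +_ (pbarO≡ovAtMost n≤N) ⟩
  ovSeries N n                                ≡⟨ ovSeries≈twistedEuler∗pSeries N n ⟩
  (twistedEuler N ∗ pSeries N) n              ≡⟨ ∗-local n (pSeries N) (λ j j≤n → cong (neg1^ j *_) (euler-pentagonal (≤-trans j≤n n≤N))) ⟩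
  (twist (pentagonalSeries N) ∗ pSeries N) n  ≡⟨ twist-pentagonalSeries-∗ n (pSeries N) (λ j≤n → cong +_ (sym (p≡pAtMost (≤-trans j≤n n≤N)))) N ⟩
  symSum N (term n)                           ∎
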